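{- Let $G=(V,E)$ be a finite connected graph and let $M,H,H'$ be maximally intersecting matchings of $G$. Then: (a) every maximal $M$-$H$ alternating chain is an odd path whose end-edges are in $M$; (b) the end-edges of maximal $M$-$H$ alternating paths are in $H'$; (c) every vertex lying on a maximal $M$-$H$ alternating path is incident to an edge of $H'$.
   Context: $\lambda(G)=\max\{|H|+|H'| : H,H' \text{ disjoint matchings}\}$, $\Lambda(G)$ the set of pairs $(H,H')$ of disjoint matchings with $|H|+|H'|=\lambda(G)$, $\mu(G)=\max\{|H|:(H,H')\in\Lambda(G)\}$, $\Lambda_\mu(G)=\{(H,H')\in\Lambda(G):|H|=\mu(G)\}$. Matchings $M,H,H'$ are maximally intersecting if: (i) $M$ is a maximum matching; (ii) $(H,H')\in\Lambda_\mu(G)$; (iii) $|M\cap(H\cup H')|$ is maximum among all triples satisfying (i)–(ii); (iv) $|M\cap H|$ is maximum among all triples satisfying (i)–(iii). For edge sets $A,B$, an $A$-$B$ alternating path (resp. cycle) is a path (resp. cycle) with at least one edge whose consecutive edges alternate between $A\setminus B$ and $B\setminus A$; a chain is such a path or cycle, and it is maximal if it is not properly contained in another such chain. An end-edge of a path is an edge of the path incident to one of its terminal vertices. Odd/even refers to the number of edges. -}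

module Defs where

open import Data.Nat using (ℕ; zero; suc; _+_; _*_; _≤_; _<_; _<ᵇ_)
open import Data.Fin using (Fin; toℕ)
open import Data.Bool using (Bool; true; false; _∧_; _∨_; not; if_then_else_; _xor_)
open import Data.List using (List; []; _∷_; _++_; length; map; allFin)
open import Data.Nat.ListAction using (sum)
open import Data.Unit using (⊤)
open import Data.List.Membership.Propositional using (_∈_)
open import Data.List.Relation.Unary.Unique.Propositional using (Unique)
open import Data.Product using (Σ; _×_; _,_; ∃)
open import Data.Sum using (_⊎_)
open import Relation.Binary.PropositionalEquality using (_≡_)
open import Relation.Nullary using (¬_)

record Graph (n : ℕ) : Set where
  field
    adj    : Fin n → Fin n → Bool
    sym    : ∀ u v → adj u v ≡ adj v u
    irrefl : ∀ u → adj u u ≡ false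
open Graph public

data Reach {n : ℕ} (G : Graph n) : Fin n → Fin n → Set where
  here : ∀ {u} → Reach G u u
  step : ∀ {u v w} → adj G u v ≡ true → Reach G v w → Reach G u w

Connected : ∀ {n} → Graph n → Set
Connected G = ∀ u v → Reach G u v

-- Sets of edges: symmetric Boolean relations (the edge {u,v} is present
-- iff S u v ≡ true).
EdgeSet : ℕ → Set
EdgeSet n = Fin n → Fin n → Bool

_∩ₑ_ : ∀ {n} → EdgeSet n → EdgeSet n → EdgeSet n
(A ∩ₑ B) u v = A u v ∧ B u v

_∪ₑ_ : ∀ {n} → EdgeSet n → EdgeSet n → EdgeSet n
(A ∪ₑ B) u v = A u v ∨ B u v

-- Number of edges: count unordered pairs u < v present in S.
size : ∀ {n} → EdgeSet n → ℕ
size {n} S = sum (map (λ u → sum (map (λ v →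
  if (toℕ u <ᵇ toℕ v) ∧ S u v then 1 else 0) (allFin n))) (allFin n))

IsEdgeSetOf : ∀ {n} → Graph n → EdgeSet n → Set
IsEdgeSetOf G S = (∀ u v → S u v ≡ S v u) × (∀ u v → S u v ≡ true → adj G u v ≡ true)

IsMatching : ∀ {n} → Graph n → EdgeSet n → Set
IsMatching G S = IsEdgeSetOf G S ×
  (∀ u v w → S u v ≡ true → S u w ≡ true → v ≡ w)

IsMaximumMatching : ∀ {n} → Graph n → EdgeSet n → Set
IsMaximumMatching G M = IsMatching G M ×
  (∀ M' → IsMatching G M' → size M' ≤ size M)

Disjoint : ∀ {n} → EdgeSet n → EdgeSet n → Set
Disjoint A B = ∀ u v → A u v ≡ true → B u v ≡ false

DisjointMatchings : ∀ {n} → Graph n → EdgeSet n → EdgeSet n → Set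
DisjointMatchings G H H' = IsMatching G H × IsMatching G H' × Disjoint H H'

-- (H , H') ∈ Λ(G): disjoint matchings with |H| + |H'| = λ(G).
InΛ : ∀ {n} → Graph n → EdgeSet n → EdgeSet n → Set
InΛ G H H' = DisjointMatchings G H H' ×
  (∀ K K' → DisjointMatchings G K K' → size K + size K' ≤ size H + size H')

-- (H , H') ∈ Λ_μ(G): moreover |H| = μ(G).
InΛμ : ∀ {n} → Graph n → EdgeSet n → EdgeSet n → Set
InΛμ G H H' = InΛ G H H' × (∀ K K' → InΛ G K K' → size K ≤ size H)

MaximallyIntersecting : ∀ {n} → Graph n → EdgeSet n → EdgeSet n → EdgeSet n → Set
MaximallyIntersecting G M H H' =
  IsMaximumMatching G M × InΛμ G H H' ×
  (∀ M₂ K K' → IsMaximumMatching G M₂ → InΛμ G K K' →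
     size (M₂ ∩ₑ (K ∪ₑ K')) ≤ size (M ∩ₑ (H ∪ₑ H'))) ×
  (∀ M₂ K K' → IsMaximumMatching G M₂ → InΛμ G K K' →
     size (M₂ ∩ₑ (K ∪ₑ K')) ≡ size (M ∩ₑ (H ∪ₑ H')) →
     size (M₂ ∩ₑ K) ≤ size (M ∩ₑ H))

-- Chains: a path is given by its list of (distinct) vertices v₀ … v_k,
-- k ≥ 1; a cycle by its list of distinct vertices v₀ … v_{k-1}, k ≥ 3,
-- with the closing edge v_{k-1} v₀.
data Chain (n : ℕ) : Set where
  path  : List (Fin n) → Chain n
  cycle : List (Fin n) → Chain n

Edge : ℕ → Set
Edge n = Fin n × Fin n

pathEdges : ∀ {n} → List (Fin n) → List (Edge n)
pathEdges []             = []
pathEdges (u ∷ [])       = []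
pathEdges (u ∷ v ∷ rest) = (u , v) ∷ pathEdges (v ∷ rest)

lastV : ∀ {n} → Fin n → List (Fin n) → Fin n
lastV u []       = u
lastV u (v ∷ vs) = lastV v vs

cycleEdges : ∀ {n} → List (Fin n) → List (Edge n)
cycleEdges []       = []
cycleEdges (u ∷ vs) = pathEdges (u ∷ vs) ++ ((lastV u vs , u) ∷ [])

edges : ∀ {n} → Chain n → List (Edge n)
edges (path vs)  = pathEdges vs
edges (cycle vs) = cycleEdges vs

InSymDiff : ∀ {n} → EdgeSet n → EdgeSet n → Edge n → Set
InSymDiff A B (u , v) = (A u v xor B u v) ≡ true

Alternate : ∀ {n} → EdgeSet n → EdgeSet n → Edge n → Edge n → Set
Alternate A B (u , v) (u' , v') =
  InSymDiff A B (u , v) × InSymDiff A B (u' , v') × (A u v xor A u' v') ≡ true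

AltSeq : ∀ {n} → EdgeSet n → EdgeSet n → List (Edge n) → Set
AltSeq A B []            = ⊤
AltSeq A B (e ∷ [])      = InSymDiff A B e
AltSeq A B (e ∷ e' ∷ es) = Alternate A B e e' × AltSeq A B (e' ∷ es)

lastE : ∀ {n} → Edge n → List (Edge n) → Edge n
lastE e []        = e
lastE e (e' ∷ es) = lastE e' es

IsAltChain : ∀ {n} → EdgeSet n → EdgeSet n → Chain n → Set
IsAltChain A B (path vs)  = Unique vs × 2 ≤ length vs × AltSeq A B (pathEdges vs)
IsAltChain A B (cycle vs) = Unique vs × 3 ≤ length vs × AltSeq A B (cycleEdges vs) ×
  (∀ e es → cycleEdges vs ≡ e ∷ es → Alternate A B (lastE e es) e)

ChainEdge : ∀ {n} → Chain n → Fin n → Fin n → Set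
ChainEdge c u v = ((u , v) ∈ edges c) ⊎ ((v , u) ∈ edges c)

ProperlyContained : ∀ {n} → Chain n → Chain n → Set
ProperlyContained c c' = (∀ u v → ChainEdge c u v → ChainEdge c' u v) ×
  Σ (Fin _) (λ u → Σ (Fin _) (λ v → ChainEdge c' u v × ¬ ChainEdge c u v))

IsMaximalAltChain : ∀ {n} → EdgeSet n → EdgeSet n → Chain n → Set
IsMaximalAltChain A B c = IsAltChain A B c ×
  (∀ c' → IsAltChain A B c' → ¬ ProperlyContained c c')

EndEdge : ∀ {n} → List (Fin n) → Fin n → Fin n → Set
EndEdge vs u v = (Σ (List (Fin _)) λ rest → vs ≡ u ∷ v ∷ rest) ⊎
                 (Σ (List (Fin _)) λ ini → vs ≡ ini ++ (u ∷ v ∷ []))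

OddNat : ℕ → Set
OddNat m = ∃ λ k → m ≡ suc (2 * k)

-- Let P be a maximal M-H alternating chain. Maximality forces every edge of M △ H at a vertex of P
-- to lie on P, so switching the M-membership of the edges of P gives a matching M ⊕ P, and
-- |M ⊕ P| − |M| = |P ∩ H| − |P ∩ M|, which is 1, 0 or −1 according as two, one or none of the end
-- edges of P lie in H. Two H end edges would make M ⊕ P larger than M. With exactly one, M ⊕ P is
-- another maximum matching meeting H ∪ H′ as often as M does ((iii) gives ≤, the count gives ≥) but
-- meeting H more often, against (iv). So both end edges lie in M and P is odd; a cycle, read as a
-- closed trail from a vertex back to itself, would then have two consecutive M-edges, so P is a path.
-- If an M-edge xy lies outside H ∪ H′ while x is free in H (or H′), putting xy into that matching and
-- dropping the edge at y either increases |H| + |H′| or keeps the pair in Λμ and increases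
-- |M ∩ (H ∪ H′)|. An end vertex of P is free in H, and every vertex of P lies on an M-edge of P;
-- this gives (b) and (c).
module Submission where

open import Defs hiding (sym; here)
import Algebra.Properties.CommutativeSemigroup as CommutativeSemigroupProperties
open import Data.Bool using (Bool; true; false; _∧_; _∨_; not; if_then_else_; _xor_)
open import Data.Bool.Properties
  using (∧-zeroʳ; ∧-identityʳ; ∨-comm; ∨-zeroʳ; ¬-not; not-¬; not-injective;
         xor-inverseʳ; xor-comm; xor-identityʳ)
  renaming (_≟_ to _≟ᵇ_)
open import Data.Empty using (⊥; ⊥-elim)
open import Data.Fin using (Fin; toℕ; zero; suc)
open import Data.Fin.Properties using (suc-injective; toℕ-injective; any?) renaming (_≟_ to _≟ᶠ_)
open import Data.List using (List; []; _∷_; _++_; length; map; allFin; tabulate)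
open import Data.List.Membership.Propositional using (_∈_; _∉_)
open import Data.List.Membership.Propositional.Properties using (∈-++⁺ˡ; ∈-++⁺ʳ)
import Data.List.Membership.DecPropositional as DecMembership
open import Data.List.Properties
  using (map-cong; map-tabulate; ++-assoc; ∷-injective; ∷-injectiveʳ; ∷ʳ-injectiveʳ; length-++-≤ˡ)
open import Data.List.Relation.Unary.All using ([])
open import Data.List.Relation.Unary.All.Properties using (¬Any⇒All¬)
open import Data.List.Relation.Unary.Any using (here; there)
open import Data.List.Relation.Unary.Unique.Propositional using (Unique; []; _∷_)
import Data.List.Relation.Unary.Unique.Propositional.Properties as UniqueProperties
open import Data.Nat using (ℕ; suc; _+_; _*_; _≤_; _<ᵇ_; z≤n; s≤s)
open import Data.Nat.ListAction using (sum)
open import Data.Nat.Properties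
  using (+-identityʳ; +-comm; +-assoc; +-suc; +-cancelʳ-≡; +-cancelˡ-≤; +-monoˡ-≤; +-mono-≤;
         ≤-refl; ≤-trans; ≤-antisym; ≮⇒≥; <-asym; <ᵇ-reflects-<; m+1+n≰m; +-commutativeSemigroup)
open import Data.Nat.Tactic.RingSolver using (solve-∀)
open import Data.Product using (Σ; _×_; _,_; ∃; proj₁; proj₂)
import Data.Product as Product
open import Data.Product.Properties using (≡-dec)
open import Data.Sum using (_⊎_; inj₁; inj₂; [_,_])
open import Data.Unit using (⊤; tt)
open import Function using (_∘_; id; flip; case_of_)
open import Relation.Binary.PropositionalEquality
  using (_≡_; _≢_; refl; sym; trans; cong; cong₂; subst; module ≡-Reasoning)
open import Relation.Nullary using (¬_; Dec; yes; no; does)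
open import Relation.Nullary.Decidable using (dec-true; dec-false; _×-dec_; _⊎-dec_)
open import Relation.Nullary.Reflects using (ofʸ; ofⁿ)

open CommutativeSemigroupProperties +-commutativeSemigroup using (interchange; xy∙z≈xz∙y)
open UniqueProperties using (Unique[x∷xs]⇒x∉xs)

-- Counting edges

+≡+-≤⇒≡ : ∀ {a k b c} → a + k ≡ b + c → k ≤ c → a ≤ b → a ≡ b
+≡+-≤⇒≡ {a} {k} {b} {c} eq k≤c a≤b = +-cancelʳ-≡ k a b (trans eq (cong (b +_) (sym k≡c)))
  where
  k≡c : k ≡ c
  k≡c = ≤-antisym k≤c (+-cancelˡ-≤ b c k (subst (_≤ b + k) eq (+-monoˡ-≤ k a≤b)))

𝟙 : Bool → ℕ
𝟙 b = if b then 1 else 0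

sum-map-+-cong : ∀ {X : Set} {f g h k : X → ℕ} → (∀ x → f x + g x ≡ h x + k x) →
  ∀ xs → sum (map f xs) + sum (map g xs) ≡ sum (map h xs) + sum (map k xs)
sum-map-+-cong eq []       = refl
sum-map-+-cong {f = f} {g} {h} {k} eq (x ∷ xs) = begin
  (f x + sum (map f xs)) + (g x + sum (map g xs)) ≡⟨ interchange (f x) _ (g x) _ ⟩
  (f x + g x) + (sum (map f xs) + sum (map g xs)) ≡⟨ cong₂ _+_ (eq x) (sum-map-+-cong eq xs) ⟩
  (h x + k x) + (sum (map h xs) + sum (map k xs)) ≡⟨ interchange (h x) (k x) _ _ ⟩
  (h x + sum (map h xs)) + (k x + sum (map k xs)) ∎
  where open ≡-Reasoning

sum-map-zero : ∀ {X : Set} {f : X → ℕ} → (∀ x → f x ≡ 0) → ∀ xs → sum (map f xs) ≡ 0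
sum-map-zero f≡0 []       = refl
sum-map-zero f≡0 (x ∷ xs) = cong₂ _+_ (f≡0 x) (sum-map-zero f≡0 xs)

sum-tabulate-zero : ∀ {n} (f : Fin n → ℕ) → (∀ v → f v ≡ 0) → sum (tabulate f) ≡ 0
sum-tabulate-zero {0}      f f≡0 = refl
sum-tabulate-zero {suc n}  f f≡0 = cong₂ _+_ (f≡0 zero) (sum-tabulate-zero (f ∘ suc) (f≡0 ∘ suc))

sum-tabulate-one : ∀ {n} (a : Fin n) (f : Fin n → ℕ) → (∀ v → v ≢ a → f v ≡ 0) →
  sum (tabulate f) ≡ f a
sum-tabulate-one zero    f off =
  trans (cong (f zero +_) (sum-tabulate-zero (f ∘ suc) λ v → off (suc v) λ ())) (+-identityʳ (f zero))
sum-tabulate-one (suc a) f off =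
  cong₂ _+_ (off zero λ ()) (sum-tabulate-one a (f ∘ suc) λ v v≢a → off (suc v) (v≢a ∘ suc-injective))

sum-tabulate-two : ∀ {n} (a b : Fin n) (f : Fin n → ℕ) → a ≢ b →
  (∀ v → v ≢ a → v ≢ b → f v ≡ 0) → sum (tabulate f) ≡ f a + f b
sum-tabulate-two zero    zero    f a≢b off = ⊥-elim (a≢b refl)
sum-tabulate-two zero    (suc b) f a≢b off =
  cong (f zero +_) (sum-tabulate-one b (f ∘ suc) λ v v≢b → off (suc v) (λ ()) (v≢b ∘ suc-injective))
sum-tabulate-two (suc a) zero    f a≢b off =
  trans (cong (f zero +_) (sum-tabulate-one a (f ∘ suc) λ v v≢a → off (suc v) (v≢a ∘ suc-injective) (λ ())))
        (+-comm (f zero) (f (suc a)))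
sum-tabulate-two (suc a) (suc b) f a≢b off =
  cong₂ _+_ (off zero (λ ()) (λ ()))
    (sum-tabulate-two a b (f ∘ suc) (a≢b ∘ cong suc)
      λ v v≢a v≢b → off (suc v) (v≢a ∘ suc-injective) (v≢b ∘ suc-injective))

sum-allFin-zero : ∀ {n} (f : Fin n → ℕ) → (∀ v → f v ≡ 0) → sum (map f (allFin n)) ≡ 0
sum-allFin-zero f f≡0 = sum-map-zero f≡0 (allFin _)

sum-allFin-one : ∀ {n} (a : Fin n) (f : Fin n → ℕ) → (∀ v → v ≢ a → f v ≡ 0) →
  sum (map f (allFin n)) ≡ f a
sum-allFin-one a f off = trans (cong sum (map-tabulate id f)) (sum-tabulate-one a f off)

sum-allFin-two : ∀ {n} (a b : Fin n) (f : Fin n → ℕ) → a ≢ b →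
  (∀ v → v ≢ a → v ≢ b → f v ≡ 0) → sum (map f (allFin n)) ≡ f a + f b
sum-allFin-two a b f a≢b off = trans (cong sum (map-tabulate id f)) (sum-tabulate-two a b f a≢b off)

size-+-pointwise : ∀ {n} {A B C D : EdgeSet n} →
  (∀ u v → 𝟙 (A u v) + 𝟙 (B u v) ≡ 𝟙 (C u v) + 𝟙 (D u v)) →
  size A + size B ≡ size C + size D
size-+-pointwise {n} {A} {B} {C} {D} eq =
  sum-map-+-cong (λ u → sum-map-+-cong (λ v → ordered (toℕ u <ᵇ toℕ v) u v) (allFin n)) (allFin n)
  where
  ordered : ∀ g u v → 𝟙 (g ∧ A u v) + 𝟙 (g ∧ B u v) ≡ 𝟙 (g ∧ C u v) + 𝟙 (g ∧ D u v)
  ordered true  = eq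
  ordered false _ _ = refl

size-cong : ∀ {n} {A B : EdgeSet n} → (∀ u v → A u v ≡ B u v) → size A ≡ size B
size-cong {n} A≡B = cong sum (map-cong (λ u → cong sum (map-cong (entry u) (allFin n))) (allFin n))
  where
  entry : ∀ u v → 𝟙 ((toℕ u <ᵇ toℕ v) ∧ _) ≡ 𝟙 ((toℕ u <ᵇ toℕ v) ∧ _)
  entry u v = cong (λ b → 𝟙 ((toℕ u <ᵇ toℕ v) ∧ b)) (A≡B u v)

size-empty : ∀ {n} {S : EdgeSet n} → (∀ u v → S u v ≡ false) → size S ≡ 0
size-empty {n} {S} S≡false =
  sum-allFin-zero _ λ u → sum-allFin-zero _ λ v → ordered (toℕ u <ᵇ toℕ v) (S≡false u v)
  where
  ordered : ∀ g {b} → b ≡ false → 𝟙 (g ∧ b) ≡ 0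
  ordered true  refl = refl
  ordered false _    = refl

size-split : ∀ {n} {A B C : EdgeSet n} → (∀ u v → 𝟙 (A u v) ≡ 𝟙 (B u v) + 𝟙 (C u v)) →
  size A ≡ size B + size C
size-split {n} {A} eq = begin
  size A                  ≡⟨ +-identityʳ (size A) ⟨
  size A + 0              ≡⟨ cong (size A +_) (size-empty {S = ∅} λ _ _ → refl) ⟨
  size A + size ∅         ≡⟨ size-+-pointwise (λ u v → trans (+-identityʳ _) (eq u v)) ⟩
  _ ∎
  where
  open ≡-Reasoning
  ∅ : EdgeSet n
  ∅ _ _ = false

Pair : ∀ {n} → Fin n → Fin n → Fin n → Fin n → Set
Pair x y u v = (u ≡ x × v ≡ y) ⊎ (u ≡ y × v ≡ x)

∧-true-left : ∀ {a b} → a ∧ b ≡ true → a ≡ true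
∧-true-left {true} _ = refl

∧-true-right : ∀ {a b} → a ∧ b ≡ true → b ≡ true
∧-true-right {true} eq = eq

𝟙-<ᵇ-both-orders : ∀ {n} {i j : Fin n} (b : Bool) → i ≢ j →
  𝟙 ((toℕ i <ᵇ toℕ j) ∧ b) + 𝟙 ((toℕ j <ᵇ toℕ i) ∧ b) ≡ 𝟙 b
𝟙-<ᵇ-both-orders {i = i} {j} b i≢j
  with toℕ i <ᵇ toℕ j | <ᵇ-reflects-< (toℕ i) (toℕ j) | toℕ j <ᵇ toℕ i | <ᵇ-reflects-< (toℕ j) (toℕ i)
... | true  | ofʸ i<j | true  | ofʸ j<i = ⊥-elim (<-asym i<j j<i)
... | true  | _       | false | _       = +-identityʳ (𝟙 b)
... | false | _       | true  | _       = refl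
... | false | ofⁿ i≮j | false | ofⁿ j≮i =
  ⊥-elim (i≢j (toℕ-injective (≤-antisym (≮⇒≥ j≮i) (≮⇒≥ i≮j))))

size-pair : ∀ {n} {S : EdgeSet n} {x y} → x ≢ y → (∀ u v → S u v ≡ S v u) →
  (∀ u v → S u v ≡ true → Pair x y u v) → size S ≡ 𝟙 (S x y)
size-pair {n} {S} {x} {y} x≢y S-sym support = begin
  size S                 ≡⟨ sum-allFin-two x y row x≢y row-off ⟩
  row x + row y          ≡⟨ cong₂ _+_ row-x row-y ⟩
  entry x y + entry y x  ≡⟨ cong (λ b → entry x y + 𝟙 ((toℕ y <ᵇ toℕ x) ∧ b)) (S-sym y x) ⟩
  _                      ≡⟨ 𝟙-<ᵇ-both-orders (S x y) x≢y ⟩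
  𝟙 (S x y) ∎
  where
  open ≡-Reasoning
  entry : Fin n → Fin n → ℕ
  entry u v = 𝟙 ((toℕ u <ᵇ toℕ v) ∧ S u v)
  row : Fin n → ℕ
  row u = sum (map (entry u) (allFin n))
  entry-off : ∀ {u v} → ¬ Pair x y u v → entry u v ≡ 0
  entry-off {u} {v} ¬pair with S u v in Suv
  ... | false = cong 𝟙 (∧-zeroʳ (toℕ u <ᵇ toℕ v))
  ... | true  = ⊥-elim (¬pair (support u v Suv))
  row-off : ∀ u → u ≢ x → u ≢ y → row u ≡ 0
  row-off u u≢x u≢y = sum-allFin-zero (entry u) λ v → entry-off
    λ { (inj₁ (u≡x , _)) → u≢x u≡x ; (inj₂ (u≡y , _)) → u≢y u≡y }
  row-x : row x ≡ entry x y
  row-x = sum-allFin-one y (entry x) λ v v≢y → entry-off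
    λ { (inj₁ (_ , v≡y)) → v≢y v≡y ; (inj₂ (x≡y , _)) → x≢y x≡y }
  row-y : row y ≡ entry y x
  row-y = sum-allFin-one x (entry y) λ v v≢x → entry-off
    λ { (inj₁ (y≡x , _)) → x≢y (sym y≡x) ; (inj₂ (_ , v≡x)) → v≢x v≡x }

-- Paths as vertex lists

module _ {n : ℕ} where

  PathEdge : List (Fin n) → Fin n → Fin n → Set
  PathEdge vs = ChainEdge (path vs)

  pathEdge? : ∀ vs u v → Dec (PathEdge vs u v)
  pathEdge? vs u v = ((u , v) ∈ᵉ? pathEdges vs) ⊎-dec ((v , u) ∈ᵉ? pathEdges vs)
    where open DecMembership (≡-dec (_≟ᶠ_ {n}) _≟ᶠ_) renaming (_∈?_ to _∈ᵉ?_)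

  opaque
    pathEdgeSet : List (Fin n) → EdgeSet n
    pathEdgeSet vs u v = does (pathEdge? vs u v)

    pathEdgeSet-true : ∀ vs {u v} → PathEdge vs u v → pathEdgeSet vs u v ≡ true
    pathEdgeSet-true vs {u} {v} = dec-true (pathEdge? vs u v)

    pathEdgeSet-false : ∀ vs {u v} → ¬ PathEdge vs u v → pathEdgeSet vs u v ≡ false
    pathEdgeSet-false vs {u} {v} = dec-false (pathEdge? vs u v)

  pathEdgeSet-cases : ∀ vs u v (P : Bool → Set) →
    (PathEdge vs u v → P true) → (¬ PathEdge vs u v → P false) → P (pathEdgeSet vs u v)
  pathEdgeSet-cases vs u v P on off with pathEdge? vs u v
  ... | yes e = subst P (sym (pathEdgeSet-true vs e)) (on e)
  ... | no ¬e = subst P (sym (pathEdgeSet-false vs ¬e)) (off ¬e)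

  PathEdge-sym : ∀ {vs u v} → PathEdge vs u v → PathEdge vs v u
  PathEdge-sym (inj₁ uv∈) = inj₂ uv∈
  PathEdge-sym (inj₂ vu∈) = inj₁ vu∈

  pathEdgeSet-sym : ∀ vs u v → pathEdgeSet vs u v ≡ pathEdgeSet vs v u
  pathEdgeSet-sym vs u v with pathEdge? vs v u
  ... | yes e = trans (pathEdgeSet-true vs (PathEdge-sym e)) (sym (pathEdgeSet-true vs e))
  ... | no ¬e = trans (pathEdgeSet-false vs (¬e ∘ PathEdge-sym)) (sym (pathEdgeSet-false vs ¬e))

  ∈-pathEdges⇒∈ : ∀ (vs : List (Fin n)) {u v} → (u , v) ∈ pathEdges vs → u ∈ vs × v ∈ vs
  ∈-pathEdges⇒∈ (x ∷ y ∷ r) (here refl) = here refl , there (here refl)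
  ∈-pathEdges⇒∈ (x ∷ y ∷ r) (there e)   = Product.map there there (∈-pathEdges⇒∈ (y ∷ r) e)

  PathEdge⇒∈ : ∀ (vs : List (Fin n)) {u v} → PathEdge vs u v → u ∈ vs × v ∈ vs
  PathEdge⇒∈ vs (inj₁ e) = ∈-pathEdges⇒∈ vs e
  PathEdge⇒∈ vs (inj₂ e) = Product.swap (∈-pathEdges⇒∈ vs e)

  pair? : ∀ (x y u v : Fin n) → Dec (Pair x y u v)
  pair? x y u v = ((u ≟ᶠ x) ×-dec (v ≟ᶠ y)) ⊎-dec ((u ≟ᶠ y) ×-dec (v ≟ᶠ x))

  Pair-sym : ∀ {x y u v : Fin n} → Pair x y u v → Pair x y v u
  Pair-sym (inj₁ (u≡x , v≡y)) = inj₂ (v≡y , u≡x)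
  Pair-sym (inj₂ (u≡y , v≡x)) = inj₁ (v≡x , u≡y)

  opaque
    pairSet : Fin n → Fin n → EdgeSet n
    pairSet x y u v = does (pair? x y u v)

    pairSet-true : ∀ {x y u v : Fin n} → Pair x y u v → pairSet x y u v ≡ true
    pairSet-true {x} {y} {u} {v} = dec-true (pair? x y u v)

    pairSet-false : ∀ {x y u v : Fin n} → ¬ Pair x y u v → pairSet x y u v ≡ false
    pairSet-false {x} {y} {u} {v} = dec-false (pair? x y u v)

  pairSet-sym : ∀ (x y u v : Fin n) → pairSet x y u v ≡ pairSet x y v u
  pairSet-sym x y u v = by-cases (pair? x y u v)
    where
    by-cases : Dec (Pair x y u v) → pairSet x y u v ≡ pairSet x y v u
    by-cases (yes p) = trans (pairSet-true p) (sym (pairSet-true (Pair-sym p)))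
    by-cases (no ¬p) = trans (pairSet-false ¬p) (sym (pairSet-false (¬p ∘ Pair-sym)))

  pairSet⇒Pair : ∀ {x y u v : Fin n} → pairSet x y u v ≡ true → Pair x y u v
  pairSet⇒Pair {x} {y} {u} {v} uv∈ with pair? x y u v
  ... | yes p = p
  ... | no ¬p with () ← trans (sym (pairSet-false ¬p)) uv∈

  size-pairSet : ∀ {x y : Fin n} → x ≢ y → size (pairSet x y) ≡ 1
  size-pairSet {x} {y} x≢y = trans (size-pair x≢y (pairSet-sym x y) (λ _ _ → pairSet⇒Pair))
                                   (cong 𝟙 (pairSet-true (inj₁ (refl , refl))))

  size-pairSet-∩ : ∀ {x y : Fin n} (X : EdgeSet n) → x ≢ y → (∀ u v → X u v ≡ X v u) →
    size (pairSet x y ∩ₑ X) ≡ 𝟙 (X x y)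
  size-pairSet-∩ {x} {y} X x≢y X-sym = begin
    size (pairSet x y ∩ₑ X)
      ≡⟨ size-pair x≢y (λ u v → cong₂ _∧_ (pairSet-sym x y u v) (X-sym u v)) support ⟩
    𝟙 (pairSet x y x y ∧ X x y)
      ≡⟨ cong (λ b → 𝟙 (b ∧ X x y)) (pairSet-true (inj₁ (refl , refl))) ⟩
    𝟙 (X x y) ∎
    where
    open ≡-Reasoning
    support : ∀ u v → (pairSet x y ∩ₑ X) u v ≡ true → Pair x y u v
    support u v uv∈ = pairSet⇒Pair (∧-true-left uv∈)

  PathEdge-here : ∀ {a b : Fin n} {r u v} → Pair a b u v → PathEdge (a ∷ b ∷ r) u v
  PathEdge-here (inj₁ (refl , refl)) = inj₁ (here refl)
  PathEdge-here (inj₂ (refl , refl)) = inj₂ (here refl)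

  PathEdge-there : ∀ {a b : Fin n} {r u v} → PathEdge (b ∷ r) u v → PathEdge (a ∷ b ∷ r) u v
  PathEdge-there (inj₁ e) = inj₁ (there e)
  PathEdge-there (inj₂ e) = inj₂ (there e)

  PathEdge-∷⁻ : ∀ {a b : Fin n} {r u v} → PathEdge (a ∷ b ∷ r) u v →
    Pair a b u v ⊎ PathEdge (b ∷ r) u v
  PathEdge-∷⁻ (inj₁ (here refl)) = inj₁ (inj₁ (refl , refl))
  PathEdge-∷⁻ (inj₁ (there e))   = inj₂ (inj₁ e)
  PathEdge-∷⁻ (inj₂ (here refl)) = inj₁ (inj₂ (refl , refl))
  PathEdge-∷⁻ (inj₂ (there e))   = inj₂ (inj₂ e)

  pathEdgeSet-∷ : ∀ {a b : Fin n} {r u v} → ¬ Pair a b u v →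
    pathEdgeSet (a ∷ b ∷ r) u v ≡ pathEdgeSet (b ∷ r) u v
  pathEdgeSet-∷ {a} {b} {r} {u} {v} ¬ab = by-cases (pathEdge? (b ∷ r) u v)
    where
    by-cases : Dec (PathEdge (b ∷ r) u v) → pathEdgeSet (a ∷ b ∷ r) u v ≡ pathEdgeSet (b ∷ r) u v
    by-cases (yes e) = trans (pathEdgeSet-true (a ∷ b ∷ r) (PathEdge-there e)) (sym (pathEdgeSet-true (b ∷ r) e))
    by-cases (no ¬e) = trans (pathEdgeSet-false (a ∷ b ∷ r) λ e′ → [ ¬ab , ¬e ] (PathEdge-∷⁻ e′))
                             (sym (pathEdgeSet-false (b ∷ r) ¬e))

  -- No edge repeats, though a vertex may: a cycle read from a vertex back to itself is a trail.
  Trail : List (Fin n) → Set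
  Trail (a ∷ b ∷ r) = a ≢ b × ¬ PathEdge (b ∷ r) a b × Trail (b ∷ r)
  Trail _           = ⊤

  unique⇒trail : ∀ vs → Unique vs → Trail vs
  unique⇒trail []          _               = tt
  unique⇒trail (_ ∷ [])    _               = tt
  unique⇒trail (a ∷ b ∷ r) u@(_ ∷ u-tail) =
    (λ a≡b → Unique[x∷xs]⇒x∉xs u (here a≡b)) ,
    (λ e → Unique[x∷xs]⇒x∉xs u (proj₁ (PathEdge⇒∈ (b ∷ r) e))) ,
    unique⇒trail (b ∷ r) u-tail

  countAlong : EdgeSet n → List (Edge n) → ℕ
  countAlong X []             = 0
  countAlong X ((u , v) ∷ es) = 𝟙 (X u v) + countAlong X es

  countAlong-mono : ∀ {X Y : EdgeSet n} → (∀ u v → X u v ≡ true → Y u v ≡ true) → ∀ es →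
    countAlong X es ≤ countAlong Y es
  countAlong-mono X⊆Y []             = z≤n
  countAlong-mono X⊆Y ((u , v) ∷ es) = +-mono-≤ (𝟙-mono (X⊆Y u v)) (countAlong-mono X⊆Y es)
    where
    𝟙-mono : ∀ {a b} → (a ≡ true → b ≡ true) → 𝟙 a ≤ 𝟙 b
    𝟙-mono {false} _   = z≤n
    𝟙-mono {true}  a⇒b rewrite a⇒b refl = ≤-refl

  size-pathEdgeSet-∩ : ∀ vs (X : EdgeSet n) → (∀ u v → X u v ≡ X v u) → Trail vs →
    size (pathEdgeSet vs ∩ₑ X) ≡ countAlong X (pathEdges vs)
  size-pathEdgeSet-∩ []          X X-sym _ =
    size-empty λ u v → cong (_∧ X u v) (pathEdgeSet-false [] λ { (inj₁ ()) ; (inj₂ ()) })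
  size-pathEdgeSet-∩ (a ∷ [])    X X-sym _ =
    size-empty λ u v → cong (_∧ X u v) (pathEdgeSet-false (a ∷ []) λ { (inj₁ ()) ; (inj₂ ()) })
  size-pathEdgeSet-∩ (a ∷ b ∷ r) X X-sym (a≢b , ab∉ , trail) = begin
    size (pathEdgeSet (a ∷ b ∷ r) ∩ₑ X)
      ≡⟨ size-split split ⟩
    size (pairSet a b ∩ₑ X) + size (pathEdgeSet (b ∷ r) ∩ₑ X)
      ≡⟨ cong₂ _+_ (size-pairSet-∩ X a≢b X-sym) (size-pathEdgeSet-∩ (b ∷ r) X X-sym trail) ⟩
    𝟙 (X a b) + countAlong X (pathEdges (b ∷ r)) ∎
    where
    open ≡-Reasoning
    split : ∀ u v → 𝟙 ((pathEdgeSet (a ∷ b ∷ r) ∩ₑ X) u v) ≡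
                    𝟙 ((pairSet a b ∩ₑ X) u v) + 𝟙 ((pathEdgeSet (b ∷ r) ∩ₑ X) u v)
    split u v = by-cases (pair? a b u v)
      where
      first-edge : ∀ {s t s′} → s ≡ true → t ≡ true → s′ ≡ false →
        𝟙 (s ∧ X u v) ≡ 𝟙 (t ∧ X u v) + 𝟙 (s′ ∧ X u v)
      first-edge refl refl refl = sym (+-identityʳ _)
      later-edge : ∀ {s t s′} → s ≡ s′ → t ≡ false →
        𝟙 (s ∧ X u v) ≡ 𝟙 (t ∧ X u v) + 𝟙 (s′ ∧ X u v)
      later-edge refl refl = refl
      by-cases : Dec (Pair a b u v) → _
      by-cases (yes p) = first-edge (pathEdgeSet-true (a ∷ b ∷ r) (PathEdge-here p)) (pairSet-true p)
        (pathEdgeSet-false (b ∷ r) λ e → ab∉ ([ (λ { (refl , refl) → e })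
                                              , (λ { (refl , refl) → PathEdge-sym e }) ] p))
      by-cases (no ¬p) = later-edge (pathEdgeSet-∷ ¬p) (pairSet-false ¬p)

  lastE-∷ʳ : ∀ (e : Edge n) es f → lastE e (es ++ f ∷ []) ≡ f
  lastE-∷ʳ e []        f = refl
  lastE-∷ʳ e (e′ ∷ es) f = lastE-∷ʳ e′ es f

  lastV-∷ʳ : ∀ (x : Fin n) r y → lastV x (r ++ y ∷ []) ≡ y
  lastV-∷ʳ x []      y = refl
  lastV-∷ʳ x (z ∷ r) y = lastV-∷ʳ z r y

  lastV-++ : ∀ (x : Fin n) ini p w → lastV x (ini ++ p ∷ w ∷ []) ≡ w
  lastV-++ x []        p w = refl
  lastV-++ x (i ∷ ini) p w = lastV-++ i ini p w

  lastV-≡ : ∀ {x : Fin n} {r} ini {p w} → x ∷ r ≡ ini ++ p ∷ w ∷ [] → lastV x r ≡ w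
  lastV-≡ []        refl = refl
  lastV-≡ (i ∷ ini) refl = lastV-++ i ini _ _

  ∷ʳ-last-≡ : ∀ (ini : List (Fin n)) {p x} ini′ {p′ w} →
    ini ++ p ∷ x ∷ [] ≡ ini′ ++ p′ ∷ w ∷ [] → x ≡ w
  ∷ʳ-last-≡ ini {p} ini′ {p′} eq = ∷ʳ-injectiveʳ (ini ++ p ∷ []) (ini′ ++ p′ ∷ [])
    (trans (++-assoc ini _ _) (trans eq (sym (++-assoc ini′ _ _))))

  unique-∷ʳ : ∀ {xs : List (Fin n)} {w} → Unique xs → w ∉ xs → Unique (xs ++ w ∷ [])
  unique-∷ʳ xs! w∉ = UniqueProperties.++⁺ xs! ([] ∷ []) λ { (w∈ , here refl) → w∉ w∈ }

  unique-∷ : ∀ {xs : List (Fin n)} {w} → w ∉ xs → Unique xs → Unique (w ∷ xs)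
  unique-∷ w∉ xs! = ¬Any⇒All¬ _ w∉ ∷ xs!

  pathEdges-∷ʳ : ∀ (x : Fin n) r y →
    pathEdges (x ∷ (r ++ y ∷ [])) ≡ pathEdges (x ∷ r) ++ (lastV x r , y) ∷ []
  pathEdges-∷ʳ x []      y = refl
  pathEdges-∷ʳ x (z ∷ r) y = cong ((x , z) ∷_) (pathEdges-∷ʳ z r y)

  pathEdges-++-∷ʳ : ∀ ini (p x w : Fin n) →
    pathEdges ((ini ++ p ∷ x ∷ []) ++ w ∷ []) ≡ pathEdges (ini ++ p ∷ x ∷ []) ++ (x , w) ∷ []
  pathEdges-++-∷ʳ []        p x w = refl
  pathEdges-++-∷ʳ (i ∷ ini) p x w =
    trans (pathEdges-∷ʳ i (ini ++ p ∷ x ∷ []) w)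
          (cong (λ y → pathEdges (i ∷ ini ++ p ∷ x ∷ []) ++ (y , w) ∷ []) (lastV-++ i ini p x))

  lastEdge : ∀ (ini : List (Fin n)) u v →
    Σ (Edge n) λ e → Σ (List (Edge n)) λ es →
      pathEdges (ini ++ u ∷ v ∷ []) ≡ e ∷ es × lastE e es ≡ (u , v)
  lastEdge []                u v = (u , v) , [] , refl , refl
  lastEdge (x ∷ [])          u v = (x , u) , (u , v) ∷ [] , refl , refl
  lastEdge (x ∷ y ∷ ini) u v with lastEdge (y ∷ ini) u v
  ... | e , es , eq , last≡ = (x , y) , e ∷ es , cong ((x , y) ∷_) eq , last≡

  lastE-pathEdges : ∀ {vs : List (Fin n)} {e es} ini {u v} → vs ≡ ini ++ u ∷ v ∷ [] →
    pathEdges vs ≡ e ∷ es → lastE e es ≡ (u , v)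
  lastE-pathEdges ini {u} {v} refl eq with lastEdge ini u v
  ... | e , es , eq′ , last≡ with refl , refl ← ∷-injective (trans (sym eq) eq′) = last≡

  lastEdge∈ : ∀ (ini : List (Fin n)) {u v} → (u , v) ∈ pathEdges (ini ++ u ∷ v ∷ [])
  lastEdge∈ []            = here refl
  lastEdge∈ (_ ∷ [])      = there (here refl)
  lastEdge∈ (_ ∷ j ∷ ini) = there (lastEdge∈ (j ∷ ini))

  last∈ : ∀ (ini : List (Fin n)) {p x} → x ∈ ini ++ p ∷ x ∷ []
  last∈ ini = ∈-++⁺ʳ ini (there (here refl))

  firstNeighbour : ∀ {x y : Fin n} {r w} → Unique (x ∷ y ∷ r) → PathEdge (x ∷ y ∷ r) x w → w ≡ y
  firstNeighbour {y = y} {r} x! e with PathEdge-∷⁻ {r = r} e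
  ... | inj₁ (inj₁ (_ , w≡y))  = w≡y
  ... | inj₁ (inj₂ (x≡y , _))  = ⊥-elim (Unique[x∷xs]⇒x∉xs x! (here x≡y))
  ... | inj₂ e′                = ⊥-elim (Unique[x∷xs]⇒x∉xs x! (proj₁ (PathEdge⇒∈ (y ∷ r) e′)))

  lastNeighbour : ∀ (ini : List (Fin n)) {p x w} → Unique (ini ++ p ∷ x ∷ []) →
    PathEdge (ini ++ p ∷ x ∷ []) x w → w ≡ p
  lastNeighbour [] u e with PathEdge-∷⁻ {r = []} e
  ... | inj₁ (inj₁ (x≡p , _)) = ⊥-elim (Unique[x∷xs]⇒x∉xs u (here (sym x≡p)))
  ... | inj₁ (inj₂ (_ , w≡p)) = w≡p
  ... | inj₂ (inj₁ ())
  ... | inj₂ (inj₂ ())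
  lastNeighbour (i ∷ []) {p} {x} u@(_ ∷ u-tail) e with PathEdge-∷⁻ {r = x ∷ []} e
  ... | inj₁ (inj₁ (x≡i , _)) = ⊥-elim (Unique[x∷xs]⇒x∉xs u (there (here (sym x≡i))))
  ... | inj₁ (inj₂ (x≡p , _)) = ⊥-elim (Unique[x∷xs]⇒x∉xs u-tail (here (sym x≡p)))
  ... | inj₂ e′               = lastNeighbour [] u-tail e′
  lastNeighbour (i ∷ j ∷ ini) {p} {x} u@(_ ∷ u-tail) e with PathEdge-∷⁻ {r = ini ++ p ∷ x ∷ []} e
  ... | inj₁ (inj₁ (x≡i , _)) = ⊥-elim (Unique[x∷xs]⇒x∉xs u (subst (_∈ _) x≡i (there (last∈ ini))))
  ... | inj₁ (inj₂ (x≡j , _)) = ⊥-elim (Unique[x∷xs]⇒x∉xs u-tail (subst (_∈ _) x≡j (last∈ ini)))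
  ... | inj₂ e′               = lastNeighbour (j ∷ ini) u-tail e′

-- Alternating edge sequences

_at_ : ∀ {n} → EdgeSet n → Edge n → Bool
S at (u , v) = S u v

xor≡true⇒≡not : ∀ a {b} → a xor b ≡ true → b ≡ not a
xor≡true⇒≡not true  {false} _ = refl
xor≡true⇒≡not false {true}  _ = refl

≢⇒xor≡true : ∀ {a b} → a ≢ b → a xor b ≡ true
≢⇒xor≡true {a} {b} a≢b = trans (cong (a xor_) (¬-not (a≢b ∘ sym))) (xor-inverseʳ a)

module Alternating {n : ℕ} (A B : EdgeSet n) where

  AltSeq-head : ∀ {e} es → AltSeq A B (e ∷ es) → InSymDiff A B e
  AltSeq-head []      e∈        = e∈
  AltSeq-head (_ ∷ _) (alt , _) = proj₁ alt

  AltSeq-tail : ∀ {e} es → AltSeq A B (e ∷ es) → AltSeq A B es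
  AltSeq-tail []      _         = tt
  AltSeq-tail (_ ∷ _) (_ , alt) = alt

  AltSeq-∈ : ∀ es {e} → AltSeq A B es → e ∈ es → InSymDiff A B e
  AltSeq-∈ (_ ∷ es) alt (here refl) = AltSeq-head es alt
  AltSeq-∈ (_ ∷ es) alt (there e∈)  = AltSeq-∈ es (AltSeq-tail es alt) e∈

  AltSeq-last : ∀ e es → AltSeq A B (e ∷ es) → InSymDiff A B (lastE e es)
  AltSeq-last e []        e∈        = e∈
  AltSeq-last e (e′ ∷ es) (_ , alt) = AltSeq-last e′ es alt

  AltSeq-∷ʳ : ∀ e es f → AltSeq A B (e ∷ es) → Alternate A B (lastE e es) f →
    AltSeq A B ((e ∷ es) ++ f ∷ [])
  AltSeq-∷ʳ e []        f _           alt-f = alt-f , proj₁ (proj₂ alt-f)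
  AltSeq-∷ʳ e (e′ ∷ es) f (alt-e , alt) alt-f = alt-e , AltSeq-∷ʳ e′ es f alt alt-f

  alternate : ∀ e f → InSymDiff A B e → InSymDiff A B f → A at e ≢ A at f → Alternate A B e f
  alternate (_ , _) (_ , _) e∈ f∈ e≢f = e∈ , f∈ , ≢⇒xor≡true e≢f

  alternating-count : ∀ e es → AltSeq A B (e ∷ es) →
    countAlong A (e ∷ es) + 1 ≡ countAlong B (e ∷ es) + 𝟙 (A at e) + 𝟙 (A at lastE e es)
  alternating-count (u , v) [] uv∈ with A u v | B u v
  ... | true  | false = refl
  ... | false | true  = refl
  alternating-count e@(u , v) (e′@(u′ , v′) ∷ es) (alt , alts) = begin
    (𝟙 (A u v) + cA) + 1                          ≡⟨ +-assoc (𝟙 (A u v)) cA 1 ⟩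
    𝟙 (A u v) + (cA + 1)                          ≡⟨ cong (𝟙 (A u v) +_) (alternating-count e′ es alts) ⟩
    𝟙 (A u v) + (cB + 𝟙 (A u′ v′) + 𝟙 (A at l))   ≡⟨ cong (λ b → 𝟙 (A u v) + (cB + 𝟙 b + 𝟙 (A at l))) A′≡B ⟩
    𝟙 (A u v) + (cB + 𝟙 (B u v) + 𝟙 (A at l))     ≡⟨ rearrange (𝟙 (A u v)) cB (𝟙 (B u v)) (𝟙 (A at l)) ⟩
    (𝟙 (B u v) + cB) + 𝟙 (A u v) + 𝟙 (A at l) ∎
    where
    open ≡-Reasoning
    cA = countAlong A (e′ ∷ es)
    cB = countAlong B (e′ ∷ es)
    l = lastE e′ es
    A′≡B : A u′ v′ ≡ B u v
    A′≡B = trans (xor≡true⇒≡not (A u v) (proj₂ (proj₂ alt)))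
                 (sym (xor≡true⇒≡not (A u v) (proj₁ alt)))
    rearrange : ∀ a c b l → a + (c + b + l) ≡ b + c + a + l
    rearrange = solve-∀

  length≡count+count : ∀ es → AltSeq A B es → length es ≡ countAlong A es + countAlong B es
  length≡count+count []             _   = refl
  length≡count+count ((u , v) ∷ es) alt =
    trans (cong suc (length≡count+count es (AltSeq-tail es alt))) (one-side (A u v) (B u v) (AltSeq-head es alt))
    where
    one-side : ∀ a b → a xor b ≡ true →
      suc (countAlong A es + countAlong B es) ≡ (𝟙 a + countAlong A es) + (𝟙 b + countAlong B es)
    one-side true  false _ = refl
    one-side false true  _ = sym (+-suc _ _)

  data IncidentWith (vs : List (Fin n)) (w : Fin n) (b : Bool) : Set where
    along    : ∀ {z} → PathEdge vs w z → A w z ≡ b → IncidentWith vs w b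
    firstEnd : ∀ {q r} → vs ≡ w ∷ q ∷ r → A w q ≡ not b → IncidentWith vs w b
    lastEnd  : ∀ {p ini} → vs ≡ ini ++ p ∷ w ∷ [] → A p w ≡ not b → IncidentWith vs w b

  incidentWith : (∀ u v → A u v ≡ A v u) → ∀ vs → AltSeq A B (pathEdges vs) → 2 ≤ length vs →
    ∀ {w} → w ∈ vs → ∀ b → IncidentWith vs w b
  incidentWith A-sym (_ ∷ []) alt (s≤s ()) _ b
  incidentWith A-sym (x ∷ y ∷ r) alt _ (here refl) b with A x y ≟ᵇ b
  ... | yes xy≡b = along (inj₁ (here refl)) xy≡b
  ... | no  xy≢b = firstEnd refl (¬-not xy≢b)
  incidentWith A-sym (x ∷ y ∷ []) alt _ (there (here refl)) b with A x y ≟ᵇ b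
  ... | yes xy≡b = along (inj₂ (here refl)) (trans (A-sym y x) xy≡b)
  ... | no  xy≢b = lastEnd {ini = []} refl (¬-not xy≢b)
  incidentWith A-sym (x ∷ y ∷ y′ ∷ r) (alt , alts) _ (there w∈) b
    with incidentWith A-sym (y ∷ y′ ∷ r) alts (s≤s (s≤s z≤n)) w∈ b
  ... | along e wz≡b              = along (PathEdge-there e) wz≡b
  ... | firstEnd refl yy′≡¬b     = along (inj₂ (here refl)) (trans (A-sym y x) xy≡b)
    where
    xy≡b : A x y ≡ b
    xy≡b = not-injective (trans (sym (xor≡true⇒≡not (A x y) (proj₂ (proj₂ alt)))) yy′≡¬b)
  ... | lastEnd {ini = ini} eq pw≡¬b = lastEnd {ini = x ∷ ini} (cong (x ∷_) eq) pw≡¬b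

-- Maximal alternating paths of two matchings

module MatchingProperties {n : ℕ} (G : Graph n) (S : EdgeSet n) (S-matching : IsMatching G S) where

  symmetric : ∀ u v → S u v ≡ S v u
  symmetric = proj₁ (proj₁ S-matching)

  adjacent : ∀ u v → S u v ≡ true → adj G u v ≡ true
  adjacent = proj₂ (proj₁ S-matching)

  functional : ∀ u v w → S u v ≡ true → S u w ≡ true → v ≡ w
  functional = proj₂ S-matching

  irreflexive : ∀ {u v} → S u v ≡ true → u ≢ v
  irreflexive {u} Suv refl with () ← trans (sym (adjacent u u Suv)) (irrefl G u)

module TwoMatchings {n : ℕ} {G : Graph n} {M H : EdgeSet n}
                    (M-matching : IsMatching G M) (H-matching : IsMatching G H) where

  open Alternating M H public
  open DecMembership (_≟ᶠ_ {n}) using (_∈?_)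

  private
    module M-match = MatchingProperties G M M-matching
    module H-match = MatchingProperties G H H-matching

  M-sym : ∀ u v → M u v ≡ M v u
  M-sym = M-match.symmetric

  InSymDiff-sym : ∀ {u v} → InSymDiff M H (u , v) → InSymDiff M H (v , u)
  InSymDiff-sym {u} {v} = trans (cong₂ _xor_ (M-match.symmetric v u) (H-match.symmetric v u))

  InSymDiff-true : ∀ {u v} → InSymDiff M H (u , v) → M u v ≡ true ⊎ H u v ≡ true
  InSymDiff-true {u} {v} uv∈ with M u v
  ... | true  = inj₁ refl
  ... | false = inj₂ uv∈

  H-true : ∀ {u v} → InSymDiff M H (u , v) → M u v ≡ false → H u v ≡ true
  H-true {u} {v} uv∈ Muv≡false = trans (cong (_xor H u v) (sym Muv≡false)) uv∈

  H-false : ∀ {u v} → InSymDiff M H (u , v) → M u v ≡ true → H u v ≡ false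
  H-false {u} {v} uv∈ Muv≡true = trans (xor≡true⇒≡not (M u v) uv∈) (cong not Muv≡true)

  InSymDiff-irrefl : ∀ {u v} → InSymDiff M H (u , v) → u ≢ v
  InSymDiff-irrefl uv∈ with InSymDiff-true uv∈
  ... | inj₁ Muv = M-match.irreflexive Muv
  ... | inj₂ Huv = H-match.irreflexive Huv

  InSymDiff⇒adj : ∀ {u v} → InSymDiff M H (u , v) → adj G u v ≡ true
  InSymDiff⇒adj {u} {v} uv∈ with InSymDiff-true uv∈
  ... | inj₁ Muv = M-match.adjacent u v Muv
  ... | inj₂ Huv = H-match.adjacent u v Huv

  InSymDiff-functional : ∀ {w x z} → InSymDiff M H (w , x) → InSymDiff M H (w , z) → M w x ≡ M w z → x ≡ z
  InSymDiff-functional {w} {x} {z} wx∈ wz∈ Mwx≡Mwz with M w x in Mwx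
  ... | true  = M-match.functional w x z Mwx (sym Mwx≡Mwz)
  ... | false = H-match.functional w x z wx∈ (H-true wz∈ (sym Mwx≡Mwz))

  PathEdge⇒InSymDiff : ∀ vs {u v} → AltSeq M H (pathEdges vs) → PathEdge vs u v → InSymDiff M H (u , v)
  PathEdge⇒InSymDiff vs alt (inj₁ e) = AltSeq-∈ (pathEdges vs) alt e
  PathEdge⇒InSymDiff vs alt (inj₂ e) = InSymDiff-sym (AltSeq-∈ (pathEdges vs) alt e)

  PathEdge-sameKind : ∀ {vs w x z} → AltSeq M H (pathEdges vs) → PathEdge vs w z → InSymDiff M H (w , x) →
    M w z ≡ M w x → PathEdge vs w x
  PathEdge-sameKind {vs} {w} alt wz wx∈ wz≡wx =
    subst (PathEdge vs w) (InSymDiff-functional (PathEdge⇒InSymDiff vs alt wz) wx∈ wz≡wx) wz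

  MaximalPath : List (Fin n) → Set
  MaximalPath vs = IsMaximalAltChain M H (path vs)

  noClosingEdge : ∀ {x q r w} → MaximalPath (x ∷ q ∷ r) → lastV q r ≡ w →
    InSymDiff M H (w , x) → M w x ≢ M x q → M at lastE (x , q) (pathEdges (q ∷ r)) ≢ M w x →
    ¬ PathEdge (x ∷ q ∷ r) w x → ⊥
  noClosingEdge {r = []} _ refl _ _ _ ¬wx = ¬wx (inj₂ (here refl))
  noClosingEdge {x} {q} {r₁ ∷ r} ((x! , _ , alt) , maximal) refl wx∈ first≢ last≢ ¬wx =
    maximal (cycle vs) (x! , s≤s (s≤s (s≤s z≤n)) , cycle-alt , closing)
                       (path⊆cycle , w , x , wx∈cycle , ¬wx)
    where
    vs = x ∷ q ∷ r₁ ∷ r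
    es = pathEdges (q ∷ r₁ ∷ r)
    w = lastV r₁ r
    cycle-alt : AltSeq M H (cycleEdges vs)
    cycle-alt = AltSeq-∷ʳ (x , q) es (w , x) alt (alternate _ _ (AltSeq-last (x , q) es alt) wx∈ last≢)
    closing : ∀ e es′ → cycleEdges vs ≡ e ∷ es′ → Alternate M H (lastE e es′) e
    closing _ _ refl = subst (λ e → Alternate M H e (x , q)) (sym (lastE-∷ʳ (x , q) es (w , x)))
                             (alternate (w , x) (x , q) wx∈ (AltSeq-head es alt) first≢)
    path⊆cycle : ∀ u v → ChainEdge (path vs) u v → ChainEdge (cycle vs) u v
    path⊆cycle u v (inj₁ e) = inj₁ (∈-++⁺ˡ e)
    path⊆cycle u v (inj₂ e) = inj₂ (∈-++⁺ˡ e)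
    wx∈cycle : ChainEdge (cycle vs) w x
    wx∈cycle = inj₁ (∈-++⁺ʳ (pathEdges vs) (here refl))

  noExtension-first : ∀ {x q r w} → MaximalPath (x ∷ q ∷ r) → InSymDiff M H (x , w) → M x w ≢ M x q →
    ¬ PathEdge (x ∷ q ∷ r) x w → ⊥
  noExtension-first {x} {q} {r} {w} max@((x! , len , alt) , maximal) xw∈ xw≢xq ¬xw with w ∈? (x ∷ q ∷ r)
  ... | no w∉ = maximal (path (w ∷ x ∷ q ∷ r))
          (unique-∷ w∉ x! , s≤s (s≤s z≤n) , alternate (w , x) (x , q) wx∈ (AltSeq-head _ alt) wx≢xq , alt)
          ((λ _ _ → PathEdge-there) , w , x , inj₁ (here refl) , ¬xw ∘ PathEdge-sym)
    where
    wx∈ : InSymDiff M H (w , x)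
    wx∈ = InSymDiff-sym xw∈
    wx≢xq : M w x ≢ M x q
    wx≢xq = xw≢xq ∘ trans (M-sym x w)
  ... | yes w∈ with incidentWith M-sym (x ∷ q ∷ r) alt len w∈ (M x w)
  ...   | along wz wz≡xw  =
          ¬xw (PathEdge-sym (PathEdge-sameKind alt wz (InSymDiff-sym xw∈) (trans wz≡xw (M-sym x w))))
  ...   | firstEnd refl _ = InSymDiff-irrefl xw∈ refl
  ...   | lastEnd {ini = ini} eq pw≡¬xw =
          noClosingEdge max (lastV-≡ ini eq) (InSymDiff-sym xw∈) (xw≢xq ∘ trans (M-sym x w)) last≢
                        (¬xw ∘ PathEdge-sym)
    where
    last≢ : M at lastE (x , q) (pathEdges (q ∷ r)) ≢ M w x
    last≢ last≡wx = not-¬ refl (trans (sym (trans last≡wx (M-sym w x)))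
                                      (trans (cong (M at_) (lastE-pathEdges ini eq refl)) pw≡¬xw))

  noExtension-last : ∀ ini {p x w} → MaximalPath (ini ++ p ∷ x ∷ []) → InSymDiff M H (x , w) →
    M x w ≢ M p x → ¬ PathEdge (ini ++ p ∷ x ∷ []) x w → ⊥
  noExtension-last ini {p} {x} {w} max@((vs! , len , alt) , maximal) xw∈ xw≢px ¬xw with w ∈? vs
    where vs = ini ++ p ∷ x ∷ []
  ... | no w∉ = maximal (path (vs ++ w ∷ []))
          (unique-∷ʳ vs! w∉ , ≤-trans len (length-++-≤ˡ vs) , extended-alt)
          (path⊆extended , x , w , xw∈extended , ¬xw)
    where
    vs = ini ++ p ∷ x ∷ []
    vs-edges : pathEdges (vs ++ w ∷ []) ≡ pathEdges vs ++ (x , w) ∷ []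
    vs-edges = pathEdges-++-∷ʳ ini p x w
    extended-alt : AltSeq M H (pathEdges (vs ++ w ∷ []))
    extended-alt with lastEdge ini p x
    ... | e , es , edges≡ , last≡px =
          subst (AltSeq M H) (trans (cong (_++ (x , w) ∷ []) (sym edges≡)) (sym vs-edges))
            (AltSeq-∷ʳ e es (x , w) alt′ (alternate _ _ (AltSeq-last e es alt′) xw∈ last≢xw))
      where
      alt′ : AltSeq M H (e ∷ es)
      alt′ = subst (AltSeq M H) edges≡ alt
      last≢xw : M at lastE e es ≢ M x w
      last≢xw last≡xw = xw≢px (trans (sym last≡xw) (cong (M at_) last≡px))
    path⊆extended : ∀ u v → ChainEdge (path vs) u v → ChainEdge (path (vs ++ w ∷ [])) u v
    path⊆extended u v (inj₁ e) = inj₁ (subst ((u , v) ∈_) (sym vs-edges) (∈-++⁺ˡ e))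
    path⊆extended u v (inj₂ e) = inj₂ (subst ((v , u) ∈_) (sym vs-edges) (∈-++⁺ˡ e))
    xw∈extended : ChainEdge (path (vs ++ w ∷ [])) x w
    xw∈extended = inj₁ (subst ((x , w) ∈_) (sym vs-edges) (∈-++⁺ʳ (pathEdges vs) (here refl)))
  ... | yes w∈ with incidentWith M-sym vs alt len w∈ (M x w)
    where vs = ini ++ p ∷ x ∷ []
  ...   | along wz wz≡xw =
          ¬xw (PathEdge-sym (PathEdge-sameKind alt wz (InSymDiff-sym xw∈) (trans wz≡xw (M-sym x w))))
  ...   | lastEnd {ini = ini′} eq _ = InSymDiff-irrefl xw∈ (∷ʳ-last-≡ ini ini′ eq)
  ...   | firstEnd {q} {r} eq wq≡¬xw =
          noClosingEdge (subst MaximalPath eq max) (lastV-≡ ini (sym eq)) xw∈ xw≢wq last≢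
                        (¬xw ∘ subst (λ vs → PathEdge vs x w) (sym eq))
    where
    xw≢wq : M x w ≢ M w q
    xw≢wq xw≡wq = not-¬ refl (trans xw≡wq wq≡¬xw)
    last≢ : M at lastE (w , q) (pathEdges (q ∷ r)) ≢ M x w
    last≢ last≡xw = xw≢px (sym (trans (sym (cong (M at_) (lastE-pathEdges ini (sym eq) refl))) last≡xw))

  maximal⇒symDiffClosed : ∀ {vs a c} → MaximalPath vs → a ∈ vs → InSymDiff M H (a , c) → PathEdge vs a c
  maximal⇒symDiffClosed {vs} {a} {c} max@((_ , len , alt) , _) a∈ ac∈ with pathEdge? vs a c
  ... | yes ac = ac
  ... | no ¬ac with incidentWith M-sym vs alt len a∈ (M a c)
  ...   | along az az≡ac = PathEdge-sameKind alt az ac∈ az≡ac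
  ...   | firstEnd refl aq≡¬ac =
          ⊥-elim (noExtension-first max ac∈ (not-¬ refl ∘ flip trans aq≡¬ac) ¬ac)
  ...   | lastEnd {ini = ini} refl pa≡¬ac =
          ⊥-elim (noExtension-last ini max ac∈ (not-¬ refl ∘ flip trans pa≡¬ac) ¬ac)

  MClosed : List (Fin n) → Set
  MClosed vs = ∀ a b c → PathEdge vs a b → M a b ≡ false → M a c ≡ true → PathEdge vs a c

  maximal⇒MClosed : ∀ vs → MaximalPath vs → MClosed vs
  maximal⇒MClosed vs max@((_ , _ , alt) , _) a b c ab Mab≡false Mac≡true with H a c in Hac
  ... | false = maximal⇒symDiffClosed max (proj₁ (PathEdge⇒∈ vs ab)) (cong₂ _xor_ Mac≡true Hac)
  ... | true  = subst (PathEdge vs a) (H-match.functional a b c Hab Hac) ab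
    where
    Hab : H a b ≡ true
    Hab = H-true (PathEdge⇒InSymDiff vs alt ab) Mab≡false

  M⊕ : List (Fin n) → EdgeSet n
  M⊕ ws u v = M u v xor pathEdgeSet ws u v

  M⊕-on : ∀ ws {u v} → PathEdge ws u v → M⊕ ws u v ≡ not (M u v)
  M⊕-on ws {u} {v} e = trans (cong (M u v xor_) (pathEdgeSet-true ws e)) (xor-comm (M u v) true)

  M⊕-off : ∀ ws {u v} → ¬ PathEdge ws u v → M⊕ ws u v ≡ M u v
  M⊕-off ws {u} {v} ¬e = trans (cong (M u v xor_) (pathEdgeSet-false ws ¬e)) (xor-identityʳ (M u v))

  M⊕-isMatching : ∀ ws → AltSeq M H (pathEdges ws) → MClosed ws → IsMatching G (M⊕ ws)
  M⊕-isMatching ws alt closed = (symmetric , adjacent) , functional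
    where
    symmetric : ∀ u v → M⊕ ws u v ≡ M⊕ ws v u
    symmetric u v = cong₂ _xor_ (M-sym u v) (pathEdgeSet-sym ws u v)
    M-false : ∀ {a b} → PathEdge ws a b → M⊕ ws a b ≡ true → M a b ≡ false
    M-false e ab∈ = not-injective (trans (sym (M⊕-on ws e)) ab∈)
    M-true : ∀ {a b} → ¬ PathEdge ws a b → M⊕ ws a b ≡ true → M a b ≡ true
    M-true ¬e ab∈ = trans (sym (M⊕-off ws ¬e)) ab∈
    adjacent : ∀ u v → M⊕ ws u v ≡ true → adj G u v ≡ true
    adjacent u v uv∈ with pathEdge? ws u v
    ... | yes e = InSymDiff⇒adj (PathEdge⇒InSymDiff ws alt e)
    ... | no ¬e = M-match.adjacent u v (M-true ¬e uv∈)
    functional : ∀ a b c → M⊕ ws a b ≡ true → M⊕ ws a c ≡ true → b ≡ c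
    functional a b c ab∈ ac∈ with pathEdge? ws a b | pathEdge? ws a c
    ... | yes ab | yes ac = H-match.functional a b c (H-true (PathEdge⇒InSymDiff ws alt ab) (M-false ab ab∈))
                                                     (H-true (PathEdge⇒InSymDiff ws alt ac) (M-false ac ac∈))
    ... | no ¬ab | no ¬ac = M-match.functional a b c (M-true ¬ab ab∈) (M-true ¬ac ac∈)
    ... | yes ab | no ¬ac = ⊥-elim (¬ac (closed a b c ab (M-false ab ab∈) (M-true ¬ac ac∈)))
    ... | no ¬ab | yes ac = ⊥-elim (¬ab (closed a c b ac (M-false ac ac∈) (M-true ¬ab ab∈)))

  size-M⊕ : ∀ ws → Trail ws → AltSeq M H (pathEdges ws) →
    size (M⊕ ws) + countAlong M (pathEdges ws) ≡ size M + countAlong H (pathEdges ws)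
  size-M⊕ ws trail alt = begin
    size (M⊕ ws) + countAlong M (pathEdges ws)
      ≡⟨ cong (size (M⊕ ws) +_) (size-pathEdgeSet-∩ ws M M-sym trail) ⟨
    size (M⊕ ws) + size (pathEdgeSet ws ∩ₑ M)
      ≡⟨ size-+-pointwise pointwise ⟩
    size M + size (pathEdgeSet ws ∩ₑ H)
      ≡⟨ cong (size M +_) (size-pathEdgeSet-∩ ws H H-match.symmetric trail) ⟩
    size M + countAlong H (pathEdges ws) ∎
    where
    open ≡-Reasoning
    pointwise : ∀ u v →
      𝟙 (M⊕ ws u v) + 𝟙 ((pathEdgeSet ws ∩ₑ M) u v) ≡ 𝟙 (M u v) + 𝟙 ((pathEdgeSet ws ∩ₑ H) u v)
    pointwise u v = pathEdgeSet-cases ws u v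
      (λ s → 𝟙 (M u v xor s) + 𝟙 (s ∧ M u v) ≡ 𝟙 (M u v) + 𝟙 (s ∧ H u v))
      (λ e → on-path (M u v) (H u v) (PathEdge⇒InSymDiff ws alt e))
      (λ _ → cong (λ b → 𝟙 b + 0) (xor-identityʳ (M u v)))
      where
      on-path : ∀ m h → m xor h ≡ true → 𝟙 (m xor true) + 𝟙 (true ∧ m) ≡ 𝟙 m + 𝟙 (true ∧ h)
      on-path true  false _ = refl
      on-path false true  _ = refl

  size-M⊕-∩-H : ∀ ws → Trail ws → AltSeq M H (pathEdges ws) →
    size (M⊕ ws ∩ₑ H) ≡ size (M ∩ₑ H) + countAlong H (pathEdges ws)
  size-M⊕-∩-H ws trail alt =
    trans (size-split pointwise) (cong (size (M ∩ₑ H) +_) (size-pathEdgeSet-∩ ws H H-match.symmetric trail))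
    where
    pointwise : ∀ u v → 𝟙 ((M⊕ ws ∩ₑ H) u v) ≡ 𝟙 ((M ∩ₑ H) u v) + 𝟙 ((pathEdgeSet ws ∩ₑ H) u v)
    pointwise u v = pathEdgeSet-cases ws u v
      (λ s → 𝟙 ((M u v xor s) ∧ H u v) ≡ 𝟙 (M u v ∧ H u v) + 𝟙 (s ∧ H u v))
      (λ e → on-path (M u v) (H u v) (PathEdge⇒InSymDiff ws alt e))
      (λ _ → trans (cong (λ b → 𝟙 (b ∧ H u v)) (xor-identityʳ (M u v))) (sym (+-identityʳ _)))
      where
      on-path : ∀ m h → m xor h ≡ true → 𝟙 ((m xor true) ∧ h) ≡ 𝟙 (m ∧ h) + 𝟙 (true ∧ h)
      on-path true  false _ = refl
      on-path false true  _ = refl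

  size-M⊕-∩-H∪H′ : ∀ {H′ : EdgeSet n} → (∀ u v → H′ u v ≡ H′ v u) →
    ∀ ws → Trail ws → AltSeq M H (pathEdges ws) →
    size (M⊕ ws ∩ₑ (H ∪ₑ H′)) + countAlong (M ∩ₑ H′) (pathEdges ws) ≡
    size (M ∩ₑ (H ∪ₑ H′)) + countAlong H (pathEdges ws)
  size-M⊕-∩-H∪H′ {H′} H′-sym ws trail alt = begin
    size (M⊕ ws ∩ₑ (H ∪ₑ H′)) + countAlong (M ∩ₑ H′) (pathEdges ws)
      ≡⟨ cong (size (M⊕ ws ∩ₑ (H ∪ₑ H′)) +_) (size-pathEdgeSet-∩ ws (M ∩ₑ H′) MH′-sym trail) ⟨
    size (M⊕ ws ∩ₑ (H ∪ₑ H′)) + size (pathEdgeSet ws ∩ₑ (M ∩ₑ H′))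
      ≡⟨ size-+-pointwise pointwise ⟩
    size (M ∩ₑ (H ∪ₑ H′)) + size (pathEdgeSet ws ∩ₑ H)
      ≡⟨ cong (size (M ∩ₑ (H ∪ₑ H′)) +_) (size-pathEdgeSet-∩ ws H H-match.symmetric trail) ⟩
    size (M ∩ₑ (H ∪ₑ H′)) + countAlong H (pathEdges ws) ∎
    where
    open ≡-Reasoning
    MH′-sym : ∀ u v → (M ∩ₑ H′) u v ≡ (M ∩ₑ H′) v u
    MH′-sym u v = cong₂ _∧_ (M-sym u v) (H′-sym u v)
    pointwise : ∀ u v → 𝟙 ((M⊕ ws ∩ₑ (H ∪ₑ H′)) u v) + 𝟙 ((pathEdgeSet ws ∩ₑ (M ∩ₑ H′)) u v) ≡
                        𝟙 ((M ∩ₑ (H ∪ₑ H′)) u v) + 𝟙 ((pathEdgeSet ws ∩ₑ H) u v)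
    pointwise u v = pathEdgeSet-cases ws u v
      (λ s → 𝟙 ((M u v xor s) ∧ (H u v ∨ H′ u v)) + 𝟙 (s ∧ (M u v ∧ H′ u v)) ≡
             𝟙 (M u v ∧ (H u v ∨ H′ u v)) + 𝟙 (s ∧ H u v))
      (λ e → on-path (M u v) (H u v) (H′ u v) (PathEdge⇒InSymDiff ws alt e))
      (λ _ → cong (λ b → 𝟙 (b ∧ (H u v ∨ H′ u v)) + 0) (xor-identityʳ (M u v)))
      where
      on-path : ∀ m h h′ → m xor h ≡ true →
        𝟙 ((m xor true) ∧ (h ∨ h′)) + 𝟙 (true ∧ (m ∧ h′)) ≡ 𝟙 (m ∧ (h ∨ h′)) + 𝟙 (true ∧ h)
      on-path true  false h′ _ = sym (+-identityʳ (𝟙 h′))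
      on-path false true  h′ _ = refl

-- Adding an edge to a matching

module AddEdge {n : ℕ} {G : Graph n} {S : EdgeSet n} (S-matching : IsMatching G S)
               {x y : Fin n} (x≢y : x ≢ y) (xy∈G : adj G x y ≡ true) (x-free : ∀ w → S x w ≡ false) where

  private
    module S-match = MatchingProperties G S S-matching

  touchesY : EdgeSet n
  touchesY u v = does (u ≟ᶠ y) ∨ does (v ≟ᶠ y)

  S⁺ : EdgeSet n
  S⁺ u v = pairSet x y u v ∨ (S u v ∧ not (touchesY u v))

  touchesY⇒ : ∀ {u v} → touchesY u v ≡ true → u ≡ y ⊎ v ≡ y
  touchesY⇒ {u} {v} t with u ≟ᶠ y | v ≟ᶠ y
  ... | yes u≡y | _       = inj₁ u≡y
  ... | no _    | yes v≡y = inj₂ v≡y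
  ... | no _    | no _    with () ← t

  touchesY-y : ∀ v → touchesY y v ≡ true
  touchesY-y v = cong (_∨ does (v ≟ᶠ y)) (dec-true (y ≟ᶠ y) refl)

  data View (u v : Fin n) : Set where
    new : Pair x y u v → View u v
    atY : ¬ Pair x y u v → touchesY u v ≡ true → View u v
    old : ¬ Pair x y u v → touchesY u v ≡ false → View u v

  view : ∀ u v → View u v
  view u v with pair? x y u v | u ≟ᶠ y | v ≟ᶠ y
  ... | yes p | _       | _       = new p
  ... | no ¬p | yes u≡y | _       = atY ¬p (cong (_∨ _) (dec-true (u ≟ᶠ y) u≡y))
  ... | no ¬p | no _    | yes v≡y = atY ¬p (trans (cong (_ ∨_) (dec-true (v ≟ᶠ y) v≡y)) (∨-zeroʳ _))
  ... | no ¬p | no u≢y  | no v≢y  =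
    old ¬p (cong₂ _∨_ (dec-false (u ≟ᶠ y) u≢y) (dec-false (v ≟ᶠ y) v≢y))

  S⁺-new : ∀ {u v} → Pair x y u v → S⁺ u v ≡ true
  S⁺-new {u} {v} p = cong (_∨ (S u v ∧ not (touchesY u v))) (pairSet-true p)

  S⁺-atY : ∀ {u v} → ¬ Pair x y u v → touchesY u v ≡ true → S⁺ u v ≡ false
  S⁺-atY {u} {v} ¬p t rewrite pairSet-false ¬p | t = ∧-zeroʳ (S u v)

  S⁺-old : ∀ {u v} → ¬ Pair x y u v → touchesY u v ≡ false → S⁺ u v ≡ S u v
  S⁺-old {u} {v} ¬p t rewrite pairSet-false ¬p | t = ∧-identityʳ (S u v)

  S-new : ∀ {u v} → Pair x y u v → S u v ≡ false
  S-new (inj₁ (refl , refl)) = x-free y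
  S-new (inj₂ (refl , refl)) = trans (S-match.symmetric y x) (x-free y)

  S⁺-isMatching : IsMatching G S⁺
  S⁺-isMatching = (symmetric , adjacent) , functional
    where
    symmetric : ∀ u v → S⁺ u v ≡ S⁺ v u
    symmetric u v = cong₂ _∨_ (pairSet-sym x y u v)
      (cong₂ (λ s t → s ∧ not t) (S-match.symmetric u v) (∨-comm (does (u ≟ᶠ y)) (does (v ≟ᶠ y))))
    adjacent : ∀ u v → S⁺ u v ≡ true → adj G u v ≡ true
    adjacent u v uv∈ with view u v
    ... | new (inj₁ (refl , refl)) = xy∈G
    ... | new (inj₂ (refl , refl)) = trans (Graph.sym G y x) xy∈G
    ... | atY ¬p t with () ← trans (sym uv∈) (S⁺-atY ¬p t)
    ... | old ¬p t = S-match.adjacent u v (trans (sym (S⁺-old ¬p t)) uv∈)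
    functional : ∀ a b c → S⁺ a b ≡ true → S⁺ a c ≡ true → b ≡ c
    functional a b c ab∈ ac∈ with view a b | view a c
    ... | atY ¬p t | _        with () ← trans (sym ab∈) (S⁺-atY ¬p t)
    ... | _        | atY ¬p t with () ← trans (sym ac∈) (S⁺-atY ¬p t)
    ... | new (inj₁ (refl , refl)) | new (inj₁ (_ , c≡y)) = sym c≡y
    ... | new (inj₂ (refl , refl)) | new (inj₂ (_ , c≡x)) = sym c≡x
    ... | new (inj₁ (refl , refl)) | new (inj₂ (x≡y , _)) = ⊥-elim (x≢y x≡y)
    ... | new (inj₂ (refl , refl)) | new (inj₁ (y≡x , _)) = ⊥-elim (x≢y (sym y≡x))
    ... | new (inj₁ (refl , refl)) | old ¬p t with () ← trans (sym ac∈) (trans (S⁺-old ¬p t) (x-free c))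
    ... | new (inj₂ (refl , refl)) | old ¬p t with () ← trans (sym (touchesY-y c)) t
    ... | old ¬p t | new (inj₁ (refl , refl)) with () ← trans (sym ab∈) (trans (S⁺-old ¬p t) (x-free b))
    ... | old ¬p t | new (inj₂ (refl , refl)) with () ← trans (sym (touchesY-y b)) t
    ... | old ¬p t | old ¬p′ t′ =
      S-match.functional a b c (trans (sym (S⁺-old ¬p t)) ab∈) (trans (sym (S⁺-old ¬p′ t′)) ac∈)

  size-S⁺ : size S⁺ + size (S ∩ₑ touchesY) ≡ size S + 1
  size-S⁺ = trans (size-+-pointwise pointwise) (cong (size S +_) (size-pairSet x≢y))
    where
    pointwise : ∀ u v → 𝟙 (S⁺ u v) + 𝟙 (S u v ∧ touchesY u v) ≡ 𝟙 (S u v) + 𝟙 (pairSet x y u v)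
    pointwise u v with view u v
    ... | new p    rewrite S⁺-new p | S-new p | pairSet-true p = refl
    ... | atY ¬p t rewrite S⁺-atY ¬p t | t | pairSet-false ¬p =
      trans (cong 𝟙 (∧-identityʳ (S u v))) (sym (+-identityʳ _))
    ... | old ¬p t rewrite S⁺-old ¬p t | t | pairSet-false ¬p =
      cong (λ b → 𝟙 (S u v) + 𝟙 b) (∧-zeroʳ (S u v))

  size-S⁺-yFree : (∀ z → S y z ≡ false) → size S⁺ ≡ size S + 1
  size-S⁺-yFree y-free = begin
    size S⁺                          ≡⟨ +-identityʳ (size S⁺) ⟨
    size S⁺ + 0                      ≡⟨ cong (size S⁺ +_) (size-empty no-y-edge) ⟨
    size S⁺ + size (S ∩ₑ touchesY)   ≡⟨ size-S⁺ ⟩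
    size S + 1 ∎
    where
    open ≡-Reasoning
    no-y-edge : ∀ u v → S u v ∧ touchesY u v ≡ false
    no-y-edge u v with touchesY u v in t
    ... | false = ∧-zeroʳ (S u v)
    ... | true with touchesY⇒ {u} {v} t
    ...   | inj₁ refl = trans (∧-identityʳ (S u v)) (y-free v)
    ...   | inj₂ refl = trans (∧-identityʳ (S u v)) (trans (S-match.symmetric u y) (y-free u))

  size-S⁺-yMatched : ∀ {z} → S y z ≡ true → size S⁺ ≡ size S
  size-S⁺-yMatched {z} yz∈ = +-cancelʳ-≡ 1 _ _ (begin
    size S⁺ + 1                      ≡⟨ cong (size S⁺ +_) y-edge ⟨
    size S⁺ + size (S ∩ₑ touchesY)   ≡⟨ size-S⁺ ⟩
    size S + 1 ∎)
    where
    open ≡-Reasoning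
    support : ∀ u v → S u v ∧ touchesY u v ≡ true → Pair y z u v
    support u v uv∈ with touchesY⇒ {u} {v} (∧-true-right uv∈)
    ... | inj₁ refl = inj₁ (refl , S-match.functional y v z (∧-true-left uv∈) yz∈)
    ... | inj₂ refl =
      inj₂ (S-match.functional y u z (trans (S-match.symmetric y u) (∧-true-left uv∈)) yz∈ , refl)
    y-edge : size (S ∩ₑ touchesY) ≡ 1
    y-edge = trans (size-pair (S-match.irreflexive yz∈) symmetric support)
                   (cong 𝟙 (trans (cong (_∧ touchesY y z) yz∈) (touchesY-y z)))
      where
      symmetric : ∀ u v → S u v ∧ touchesY u v ≡ S v u ∧ touchesY v u
      symmetric u v = cong₂ _∧_ (S-match.symmetric u v) (∨-comm (does (u ≟ᶠ y)) (does (v ≟ᶠ y)))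

-- Maximally intersecting matchings

module MaximallyIntersectingTriple {n : ℕ} {G : Graph n} {M H H′ : EdgeSet n}
                                   (mi : MaximallyIntersecting G M H H′) where

  private
    M-maximum : IsMaximumMatching G M
    M-maximum = proj₁ mi
    HH′∈Λμ : InΛμ G H H′
    HH′∈Λμ = proj₁ (proj₂ mi)
    HH′∈Λ : InΛ G H H′
    HH′∈Λ = proj₁ HH′∈Λμ
    H-matching : IsMatching G H
    H-matching = proj₁ (proj₁ HH′∈Λ)
    H′-matching : IsMatching G H′
    H′-matching = proj₁ (proj₂ (proj₁ HH′∈Λ))
    H∩H′≡∅ : Disjoint H H′
    H∩H′≡∅ = proj₂ (proj₂ (proj₁ HH′∈Λ))
    most-in-H∪H′ : ∀ M₂ K K′ → IsMaximumMatching G M₂ → InΛμ G K K′ →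
      size (M₂ ∩ₑ (K ∪ₑ K′)) ≤ size (M ∩ₑ (H ∪ₑ H′))
    most-in-H∪H′ = proj₁ (proj₂ (proj₂ mi))
    most-in-H : ∀ M₂ K K′ → IsMaximumMatching G M₂ → InΛμ G K K′ →
      size (M₂ ∩ₑ (K ∪ₑ K′)) ≡ size (M ∩ₑ (H ∪ₑ H′)) → size (M₂ ∩ₑ K) ≤ size (M ∩ₑ H)
    most-in-H = proj₂ (proj₂ (proj₂ mi))
    module M-match = MatchingProperties G M (proj₁ M-maximum)
    module H-match = MatchingProperties G H H-matching
    module H′-match = MatchingProperties G H′ H′-matching

  open TwoMatchings {G = G} {M} {H} (proj₁ M-maximum) H-matching

  endEdges∈M : ∀ ws → Trail ws → AltSeq M H (pathEdges ws) → MClosed ws →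
    ∀ {e es} → pathEdges ws ≡ e ∷ es → M at e ≡ true × M at lastE e es ≡ true
  endEdges∈M ws trail alt closed {e} {es} edges≡ = by-cases (M at e) (M at lastE e es) refl refl
    where
    cM = countAlong M (pathEdges ws)
    cH = countAlong H (pathEdges ws)
    count : cM + 1 ≡ cH + 𝟙 (M at e) + 𝟙 (M at lastE e es)
    count = subst (λ es′ → countAlong M es′ + 1 ≡ countAlong H es′ + 𝟙 (M at e) + 𝟙 (M at lastE e es))
                  (sym edges≡) (alternating-count e es (subst (AltSeq M H) edges≡ alt))
    M⊕-matching : IsMatching G (M⊕ ws)
    M⊕-matching = M⊕-isMatching ws alt closed
    M⊕-size : size (M⊕ ws) + cM ≡ size M + cH
    M⊕-size = size-M⊕ ws trail alt
    not-augmenting : cM + 1 ≢ cH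
    not-augmenting cM+1≡cH =
      m+1+n≰m (size M) {0} (subst (_≤ size M) size≡ (proj₂ M-maximum (M⊕ ws) M⊕-matching))
      where
      size≡ : size (M⊕ ws) ≡ size M + 1
      size≡ = +-cancelʳ-≡ cM _ _ (begin
        size (M⊕ ws) + cM      ≡⟨ M⊕-size ⟩
        size M + cH            ≡⟨ cong (size M +_) (trans (sym cM+1≡cH) (+-comm cM 1)) ⟩
        size M + (1 + cM)      ≡⟨ +-assoc (size M) 1 cM ⟨
        size M + 1 + cM ∎)
        where open ≡-Reasoning
    not-balanced : cM ≢ cH
    not-balanced cM≡cH with positive cH (trans (cong (_+ cH) (sym cM≡cH))
                                        (trans (sym (length≡count+count (pathEdges ws) alt)) (cong length edges≡)))
      where
      positive : ∀ c → c + c ≡ suc (length es) → ∃ λ k → c ≡ suc k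
      positive (suc k) _ = k , refl
    ... | k , cH≡1+k = m+1+n≰m (size (M ∩ₑ H)) (subst (_≤ size (M ∩ₑ H)) M⊕∩H-size more-in-H)
      where
      size≡ : size (M⊕ ws) ≡ size M
      size≡ = +-cancelʳ-≡ cM _ _ (trans M⊕-size (cong (size M +_) (sym cM≡cH)))
      M⊕-maximum : IsMaximumMatching G (M⊕ ws)
      M⊕-maximum = M⊕-matching , λ M′ M′-matching →
        subst (size M′ ≤_) (sym size≡) (proj₂ M-maximum M′ M′-matching)
      same-in-H∪H′ : size (M⊕ ws ∩ₑ (H ∪ₑ H′)) ≡ size (M ∩ₑ (H ∪ₑ H′))
      same-in-H∪H′ = +≡+-≤⇒≡ (size-M⊕-∩-H∪H′ H′-match.symmetric ws trail alt)
        (subst (countAlong (M ∩ₑ H′) (pathEdges ws) ≤_) cM≡cH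
               (countAlong-mono (λ _ _ → ∧-true-left) (pathEdges ws)))
        (most-in-H∪H′ (M⊕ ws) H H′ M⊕-maximum HH′∈Λμ)
      more-in-H : size (M⊕ ws ∩ₑ H) ≤ size (M ∩ₑ H)
      more-in-H = most-in-H (M⊕ ws) H H′ M⊕-maximum HH′∈Λμ same-in-H∪H′
      M⊕∩H-size : size (M⊕ ws ∩ₑ H) ≡ size (M ∩ₑ H) + suc k
      M⊕∩H-size = trans (size-M⊕-∩-H ws trail alt) (cong (size (M ∩ₑ H) +_) cH≡1+k)
    by-cases : ∀ a b → M at e ≡ a → M at lastE e es ≡ b → M at e ≡ true × M at lastE e es ≡ true
    by-cases a b first last with trans count (cong₂ (λ a b → cH + 𝟙 a + 𝟙 b) first last)
    by-cases true  true  first last | _      = first , last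
    by-cases false false first last | count′ =
      ⊥-elim (not-augmenting (trans count′ (trans (+-identityʳ (cH + 0)) (+-identityʳ cH))))
    by-cases true  false first last | count′ =
      ⊥-elim (not-balanced (+-cancelʳ-≡ 1 cM cH (trans count′ (+-identityʳ (cH + 1)))))
    by-cases false true  first last | count′ =
      ⊥-elim (not-balanced (+-cancelʳ-≡ 1 cM cH (trans count′ (cong (_+ 1) (+-identityʳ cH)))))

  noAlternatingCycle : ∀ vs → ¬ IsAltChain M H (cycle vs)
  noAlternatingCycle []               (_ , () , _)
  noAlternatingCycle (_ ∷ [])         (_ , s≤s () , _)
  noAlternatingCycle (_ ∷ _ ∷ [])     (_ , s≤s (s≤s ()) , _)
  noAlternatingCycle (x ∷ r₀ ∷ r₁ ∷ r) (vs!@(_ ∷ rest-unique) , _ , cycle-alt , closing) =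
    ends-differ (endEdges∈M ws trail alt closed refl)
    where
    rest = r₀ ∷ r₁ ∷ r
    ws = x ∷ (rest ++ x ∷ [])
    c = (lastV r₁ r , x)
    ws≡cycle : pathEdges ws ≡ cycleEdges (x ∷ rest)
    ws≡cycle = pathEdges-∷ʳ x rest x
    alt : AltSeq M H (pathEdges ws)
    alt = subst (AltSeq M H) (sym ws≡cycle) cycle-alt
    x∉rest : x ∉ rest
    x∉rest = Unique[x∷xs]⇒x∉xs vs!
    rest! : Unique (rest ++ x ∷ [])
    rest! = unique-∷ʳ rest-unique x∉rest
    trail : Trail ws
    trail = (λ x≡r₀ → x∉rest (here x≡r₀)) ,
            (λ r₀x → x∉rest (there (here (firstNeighbour rest! (PathEdge-sym r₀x))))) ,
            unique⇒trail (rest ++ x ∷ []) rest!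
    closing-alt : Alternate M H c (x , r₀)
    closing-alt = subst (λ e → Alternate M H e (x , r₀)) (lastE-∷ʳ (x , r₀) (pathEdges rest) c)
                        (closing (x , r₀) (pathEdges rest ++ c ∷ []) refl)
    last≡c : lastE (x , r₀) (pathEdges (rest ++ x ∷ [])) ≡ c
    last≡c = trans (cong (lastE (x , r₀)) (∷-injectiveʳ ws≡cycle))
                   (lastE-∷ʳ (x , r₀) (pathEdges rest) c)
    c∈ws : PathEdge ws x (lastV r₁ r)
    c∈ws = inj₂ (subst (c ∈_) (sym ws≡cycle) (∈-++⁺ʳ (pathEdges (x ∷ rest)) (here refl)))
    closed : MClosed ws
    closed a b d ab Mab≡false Mad≡true
      with incidentWith M-sym ws alt (s≤s (s≤s z≤n)) (proj₁ (PathEdge⇒∈ ws ab)) true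
    ... | along az Maz≡true = subst (PathEdge ws a) (M-match.functional a _ d Maz≡true Mad≡true) az
    ... | firstEnd refl Mxr₀≡false =
          subst (PathEdge ws x) (M-match.functional x _ d (trans (M-sym x _) Mc≡true) Mad≡true) c∈ws
      where
      Mc≡true : M at c ≡ true
      Mc≡true = not-injective
        (trans (sym (xor≡true⇒≡not (M at c) (proj₂ (proj₂ closing-alt)))) Mxr₀≡false)
    ... | lastEnd {ini = ini} eq Mpa≡false with trans (sym (lastV-∷ʳ x rest x)) (lastV-≡ ini eq)
    ...   | refl = subst (PathEdge ws x) (M-match.functional x r₀ d Mxr₀≡true Mad≡true) (inj₁ (here refl))
      where
      Mc≡false : M at c ≡ false
      Mc≡false = trans (cong (M at_) (trans (sym last≡c) (lastE-pathEdges ini eq refl))) Mpa≡false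
      Mxr₀≡true : M x r₀ ≡ true
      Mxr₀≡true = trans (xor≡true⇒≡not (M at c) (proj₂ (proj₂ closing-alt))) (cong not Mc≡false)
    ends-differ : M x r₀ ≡ true × M at lastE (x , r₀) (pathEdges (rest ++ x ∷ [])) ≡ true → ⊥
    ends-differ (first∈M , last∈M)
      with () ← trans (sym (cong₂ _xor_ (trans (cong (M at_) (sym last≡c)) last∈M) first∈M))
                      (proj₂ (proj₂ closing-alt))

  maximalPath-ends∈M : ∀ {x q r} → MaximalPath (x ∷ q ∷ r) →
    M x q ≡ true × M at lastE (x , q) (pathEdges (q ∷ r)) ≡ true
  maximalPath-ends∈M max@((vs! , _ , alt) , _) =
    endEdges∈M _ (unique⇒trail _ vs!) alt (maximal⇒MClosed _ max) refl

  endEdge∈M : ∀ vs → MaximalPath vs → ∀ u v → EndEdge vs u v → M u v ≡ true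
  endEdge∈M []          ((_ , () , _) , _)
  endEdge∈M (_ ∷ [])    ((_ , s≤s () , _) , _)
  endEdge∈M (x ∷ q ∷ r) max u v (inj₁ (_ , refl))  = proj₁ (maximalPath-ends∈M max)
  endEdge∈M (x ∷ q ∷ r) max u v (inj₂ (ini , eq)) =
    trans (cong (M at_) (sym (lastE-pathEdges ini eq refl))) (proj₂ (maximalPath-ends∈M max))

  maximalChain⇒oddPath : ∀ c → IsMaximalAltChain M H c →
    Σ (List (Fin n)) λ vs → c ≡ path vs × OddNat (length (pathEdges vs)) ×
                            (∀ u v → EndEdge vs u v → M u v ≡ true)
  maximalChain⇒oddPath (cycle vs)          max = ⊥-elim (noAlternatingCycle vs (proj₁ max))
  maximalChain⇒oddPath (path [])           ((_ , () , _) , _)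
  maximalChain⇒oddPath (path (_ ∷ []))     ((_ , s≤s () , _) , _)
  maximalChain⇒oddPath (path vs@(x ∷ q ∷ r)) max@((_ , _ , alt) , _) = vs , refl , odd , endEdge∈M vs max
    where
    es = pathEdges (q ∷ r)
    cM = countAlong M (pathEdges vs)
    cH = countAlong H (pathEdges vs)
    cM≡1+cH : cM ≡ suc cH
    cM≡1+cH = +-cancelʳ-≡ 1 cM (suc cH) (begin
      cM + 1                                   ≡⟨ alternating-count (x , q) es alt ⟩
      cH + 𝟙 (M x q) + 𝟙 (M at lastE (x , q) es) ≡⟨ cong₂ (λ a b → cH + 𝟙 a + 𝟙 b) first∈M last∈M ⟩
      cH + 1 + 1                               ≡⟨ cong (_+ 1) (+-comm cH 1) ⟩
      suc cH + 1 ∎)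
      where
      open ≡-Reasoning
      first∈M : M x q ≡ true
      first∈M = proj₁ (maximalPath-ends∈M max)
      last∈M : M at lastE (x , q) es ≡ true
      last∈M = proj₂ (maximalPath-ends∈M max)
    odd : OddNat (length (pathEdges vs))
    odd = cH , (begin
      length (pathEdges vs) ≡⟨ length≡count+count (pathEdges vs) alt ⟩
      cM + cH               ≡⟨ cong (_+ cH) cM≡1+cH ⟩
      suc cH + cH           ≡⟨ cong suc (cong (cH +_) (+-identityʳ cH)) ⟨
      suc (2 * cH) ∎)
      where open ≡-Reasoning

  module AddMEdge {K L : EdgeSet n} (K-matching : IsMatching G K) (L-sym : ∀ u v → L u v ≡ L v u)
                  {x y : Fin n} (Mxy : M x y ≡ true) (Kxy : K x y ≡ false) (Lxy : L x y ≡ false)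
                  (x-free : ∀ w → K x w ≡ false) where

    open AddEdge {G = G} {S = K} K-matching (M-match.irreflexive Mxy) (M-match.adjacent x y Mxy) x-free public

    L-new : ∀ {u v} → Pair x y u v → L u v ≡ false
    L-new (inj₁ (refl , refl)) = Lxy
    L-new (inj₂ (refl , refl)) = trans (L-sym y x) Lxy

    M-new : ∀ {u v} → Pair x y u v → M u v ≡ true
    M-new (inj₁ (refl , refl)) = Mxy
    M-new (inj₂ (refl , refl)) = trans (M-sym y x) Mxy

    M-atY : ∀ {u v} → ¬ Pair x y u v → touchesY u v ≡ true → M u v ≡ false
    M-atY {u} {v} ¬p t with M u v in Muv | touchesY⇒ {u} {v} t
    ... | false | _         = refl
    ... | true  | inj₁ refl = ⊥-elim (¬p (inj₂ (refl , M-match.functional y v x Muv (trans (M-sym y x) Mxy))))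
    ... | true  | inj₂ refl =
      ⊥-elim (¬p (inj₁ (M-match.functional y u x (trans (M-sym y u) Muv) (trans (M-sym y x) Mxy) , refl)))

    S⁺∩L≡∅ : Disjoint K L → Disjoint S⁺ L
    S⁺∩L≡∅ K∩L≡∅ u v uv∈ with view u v
    ... | new p    = L-new p
    ... | atY ¬p t with () ← trans (sym uv∈) (S⁺-atY ¬p t)
    ... | old ¬p t = K∩L≡∅ u v (trans (sym (S⁺-old ¬p t)) uv∈)

    L∩S⁺≡∅ : Disjoint L K → Disjoint L S⁺
    L∩S⁺≡∅ L∩K≡∅ u v uv∈ with view u v
    ... | new p    with () ← trans (sym uv∈) (L-new p)
    ... | atY ¬p t = S⁺-atY ¬p t
    ... | old ¬p t = trans (S⁺-old ¬p t) (L∩K≡∅ u v uv∈)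

    more-in-S⁺∪L : size (M ∩ₑ (S⁺ ∪ₑ L)) ≡ size (M ∩ₑ (K ∪ₑ L)) + 1
    more-in-S⁺∪L =
      trans (size-split pointwise) (cong (size (M ∩ₑ (K ∪ₑ L)) +_) (size-pairSet (M-match.irreflexive Mxy)))
      where
      pointwise : ∀ u v →
        𝟙 (M u v ∧ (S⁺ u v ∨ L u v)) ≡ 𝟙 (M u v ∧ (K u v ∨ L u v)) + 𝟙 (pairSet x y u v)
      pointwise u v with view u v
      ... | new p    rewrite M-new p | S⁺-new p | S-new p | L-new p | pairSet-true p = refl
      ... | atY ¬p t rewrite M-atY ¬p t | pairSet-false ¬p = refl
      ... | old ¬p t rewrite S⁺-old ¬p t | pairSet-false ¬p = sym (+-identityʳ _)

    more-in-L∪S⁺ : size (M ∩ₑ (L ∪ₑ S⁺)) ≡ size (M ∩ₑ (L ∪ₑ K)) + 1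
    more-in-L∪S⁺ = trans (size-cong λ u v → cong (M u v ∧_) (∨-comm (L u v) (S⁺ u v)))
                         (trans more-in-S⁺∪L (cong (_+ 1) (size-cong λ u v → cong (M u v ∧_) (∨-comm (K u v) (L u v)))))

  private
    no-larger-pair : ∀ {K K′} → DisjointMatchings G K K′ → size K + size K′ ≡ size H + size H′ + 1 → ⊥
    no-larger-pair KK′ larger =
      m+1+n≰m (size H + size H′) {0} (subst (_≤ size H + size H′) larger (proj₂ HH′∈Λ _ _ KK′))

    no-better-pair : ∀ {K K′} → InΛμ G K K′ → size (M ∩ₑ (K ∪ₑ K′)) ≡ size (M ∩ₑ (H ∪ₑ H′)) + 1 → ⊥
    no-better-pair KK′ better = m+1+n≰m (size (M ∩ₑ (H ∪ₑ H′))) {0}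
      (subst (_≤ size (M ∩ₑ (H ∪ₑ H′))) better (most-in-H∪H′ M _ _ M-maximum KK′))

    same-sizes⇒InΛμ : ∀ {K K′} → DisjointMatchings G K K′ → size K ≡ size H → size K′ ≡ size H′ → InΛμ G K K′
    same-sizes⇒InΛμ {K} {K′} KK′ K≡H K′≡H′ =
      (KK′ , λ L L′ LL′ → subst (size L + size L′ ≤_) (sym (cong₂ _+_ K≡H K′≡H′)) (proj₂ HH′∈Λ L L′ LL′)) ,
      λ L L′ LL′ → subst (size L ≤_) (sym K≡H) (proj₂ HH′∈Λμ L L′ LL′)

  noAddableMEdge : ∀ {x y} → M x y ≡ true → H x y ≡ false → H′ x y ≡ false →
    (∀ w → H x w ≡ false) ⊎ (∀ w → H′ x w ≡ false) → ⊥
  noAddableMEdge {x} {y} Mxy Hxy H′xy (inj₁ H-free) with any? (λ z → H y z ≟ᵇ true)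
  ... | no y-free = no-larger-pair S⁺H′ (trans (cong (_+ size H′) (size-S⁺-yFree λ z → ¬-not (y-free ∘ (z ,_))))
                                              (xy∙z≈xz∙y (size H) 1 (size H′)))
    where open AddMEdge H-matching H′-match.symmetric Mxy Hxy H′xy H-free
          S⁺H′ : DisjointMatchings G S⁺ H′
          S⁺H′ = S⁺-isMatching , H′-matching , S⁺∩L≡∅ H∩H′≡∅
  ... | yes (_ , Hyz) = no-better-pair (same-sizes⇒InΛμ S⁺H′ (size-S⁺-yMatched Hyz) refl) more-in-S⁺∪L
    where open AddMEdge H-matching H′-match.symmetric Mxy Hxy H′xy H-free
          S⁺H′ : DisjointMatchings G S⁺ H′
          S⁺H′ = S⁺-isMatching , H′-matching , S⁺∩L≡∅ H∩H′≡∅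
  noAddableMEdge {x} {y} Mxy Hxy H′xy (inj₂ H′-free) with any? (λ z → H′ y z ≟ᵇ true)
  ... | no y-free = no-larger-pair HS⁺ (trans (cong (size H +_) (size-S⁺-yFree λ z → ¬-not (y-free ∘ (z ,_))))
                                             (sym (+-assoc (size H) (size H′) 1)))
    where open AddMEdge H′-matching H-match.symmetric Mxy H′xy Hxy H′-free
          HS⁺ : DisjointMatchings G H S⁺
          HS⁺ = H-matching , S⁺-isMatching , L∩S⁺≡∅ H∩H′≡∅
  ... | yes (_ , H′yz) = no-better-pair (same-sizes⇒InΛμ HS⁺ refl (size-S⁺-yMatched H′yz)) more-in-L∪S⁺
    where open AddMEdge H′-matching H-match.symmetric Mxy H′xy Hxy H′-free
          HS⁺ : DisjointMatchings G H S⁺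
          HS⁺ = H-matching , S⁺-isMatching , L∩S⁺≡∅ H∩H′≡∅

  endVertex-H-free : ∀ {vs a b} → MaximalPath vs → PathEdge vs a b →
    (∀ {w} → PathEdge vs a w → w ≡ b) → M a b ≡ true → ∀ w → H a w ≡ false
  endVertex-H-free {vs} {a} {b} max@((_ , _ , alt) , _) ab only-b Mab w = ¬-not no-H-edge
    where
    no-H-edge : H a w ≢ true
    no-H-edge Haw =
      case trans (sym (H-false (PathEdge⇒InSymDiff vs alt ab) Mab)) (subst (λ z → H a z ≡ true) w≡b Haw) of λ ()
      where
      w≡b : w ≡ b
      w≡b with M a w in Maw
      ... | true  = M-match.functional a w b Maw Mab
      ... | false = only-b (maximal⇒symDiffClosed max (proj₁ (PathEdge⇒∈ vs ab)) (cong₂ _xor_ Maw Haw))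

  endEdge∈H′ : ∀ vs → MaximalPath vs → ∀ u v → EndEdge vs u v → H′ u v ≡ true
  endEdge∈H′ vs max u v end with H′ u v in H′uv
  ... | true  = refl
  ... | false with end
  ...   | inj₁ (_ , refl) = ⊥-elim (noAddableMEdge Muv (u-free v) H′uv (inj₁ u-free))
    where
    Muv : M u v ≡ true
    Muv = endEdge∈M vs max u v end
    u-free : ∀ w → H u w ≡ false
    u-free = endVertex-H-free max (inj₁ (here refl)) (firstNeighbour (proj₁ (proj₁ max))) Muv
  ...   | inj₂ (ini , refl) =
          ⊥-elim (noAddableMEdge Mvu (v-free u) (trans (H′-match.symmetric v u) H′uv) (inj₁ v-free))
    where
    Mvu : M v u ≡ true
    Mvu = trans (M-sym v u) (endEdge∈M vs max u v end)
    v-free : ∀ w → H v w ≡ false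
    v-free = endVertex-H-free max (inj₂ (lastEdge∈ ini)) (lastNeighbour ini (proj₁ (proj₁ max))) Mvu

  pathVertex-coveredBy-H′ : ∀ vs → MaximalPath vs → ∀ x → x ∈ vs → ∃ λ y → H′ x y ≡ true
  pathVertex-coveredBy-H′ vs max@((_ , len , alt) , _) x x∈ with any? (λ y → H′ x y ≟ᵇ true)
  ... | yes covered = covered
  ... | no uncovered with incidentWith M-sym vs alt len x∈ true
  ...   | along xz Mxz =
          ⊥-elim (noAddableMEdge Mxz (H-false (PathEdge⇒InSymDiff vs alt xz) Mxz) (H′-free _) (inj₂ H′-free))
    where
    H′-free : ∀ w → H′ x w ≡ false
    H′-free w = ¬-not (uncovered ∘ (w ,_))
  ...   | firstEnd eq Mxq≡false =
          case trans (sym (endEdge∈M vs max _ _ (inj₁ (_ , eq)))) Mxq≡false of λ ()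
  ...   | lastEnd {ini = ini} eq Mpx≡false =
          case trans (sym (endEdge∈M vs max _ _ (inj₂ (ini , eq)))) Mpx≡false of λ ()

mainTheorem11 : ∀ {n} (G : Graph n) → Connected G →
    (M H H' : EdgeSet n) → MaximallyIntersecting G M H H' →
    -- (a)
    (∀ c → IsMaximalAltChain M H c →
       Σ (List (Fin n)) λ vs → c ≡ path vs × OddNat (length (pathEdges vs)) ×
         (∀ u v → EndEdge vs u v → M u v ≡ true))
    -- (b)
    × (∀ vs → IsMaximalAltChain M H (path vs) →
         ∀ u v → EndEdge vs u v → H' u v ≡ true)
    -- (c)
    × (∀ vs → IsMaximalAltChain M H (path vs) →
         ∀ x → x ∈ vs → ∃ λ y → H' x y ≡ true)
mainTheorem11 G _ M H H' mi = maximalChain⇒oddPath , endEdge∈H′ , pathVertex-coveredBy-H′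
  where open MaximallyIntersectingTriple {G = G} {M} {H} {H'} mi
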